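{- Let $G$ be a simple graph embeddable in the torus which has no nice colouring, and which is minimal with this property, in the sense that every graph embeddable in the torus with fewer vertices than $G$ has a nice colouring. If $v$ is a vertex of $G$ of degree $5$, then $v$ has at most one neighbour of odd degree.
   Context: A nice colouring of a simple graph is a proper vertex-colouring with at most $9$ colours such that for every non-isolated vertex $v$, some colour appears an odd number of times among the colours of the neighbours of $v$. -}

module Defs where

open import Data.Bool using (Bool; true; false; _∧_; _∨_; not; if_then_else_)
open import Data.Nat using (ℕ; zero; suc; _+_; _*_; _≤_; _<_; _%_; _<ᵇ_)
open import Data.Fin using (Fin; toℕ)
open import Data.Product using (Σ; ∃; _×_; _,_)
open import Relation.Binary.PropositionalEquality using (_≡_; _≢_)
open import Relation.Nullary using (¬_)

record SimpleGraph (n : ℕ) : Set where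
  field
    adj    : Fin n → Fin n → Bool
    sym    : ∀ u v → adj u v ≡ adj v u
    irrefl : ∀ v → adj v v ≡ false
open SimpleGraph public

count : ∀ {n} → (Fin n → Bool) → ℕ
count {zero}  p = 0
count {suc n} p = (if p Fin.zero then 1 else 0) + count (λ i → p (Fin.suc i))
  where import Data.Fin as Fin

anyF : ∀ {n} → (Fin n → Bool) → Bool
anyF {zero}  p = false
anyF {suc n} p = p Data.Fin.zero ∨ anyF (λ i → p (Data.Fin.suc i))
  where import Data.Fin

_==_ : ∀ {n} → Fin n → Fin n → Bool
a == b = Data.Nat._≡ᵇ_ (toℕ a) (toℕ b)
  where import Data.Nat

sumF : ∀ {n} → (Fin n → ℕ) → ℕ
sumF {zero}  f = 0
sumF {suc n} f = f Data.Fin.zero + sumF (λ i → f (Data.Fin.suc i))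
  where import Data.Fin

iter : ∀ {A : Set} → (A → A) → ℕ → A → A
iter f zero    x = x
iter f (suc k) x = f (iter f k x)

module _ {n : ℕ} (G : SimpleGraph n) where

  degree : Fin n → ℕ
  degree v = count (adj G v)

  isolated : Fin n → Bool
  isolated v = not (anyF (adj G v))

  edgeCount : ℕ
  edgeCount = sumF (λ u → count (λ w → adj G u w ∧ (toℕ u <ᵇ toℕ w)))

  Proper : (Fin n → Fin 9) → Set
  Proper c = ∀ u v → adj G u v ≡ true → c u ≢ c v

  OddCondition : (Fin n → Fin 9) → Set
  OddCondition c = ∀ v → degree v ≢ 0 →
    ∃ λ (i : Fin 9) → count (λ u → adj G v u ∧ (c u == i)) % 2 ≡ 1

  NiceColouring : (Fin n → Fin 9) → Set
  NiceColouring c = Proper c × OddCondition c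

  HasNiceColouring : Set
  HasNiceColouring = ∃ λ c → NiceColouring c

  -- Embeddability in the torus, via rotation systems
  -- (Heffter–Edmonds combinatorial description of orientable
  -- embeddings).
  -- ρ v u = successor of the neighbour u in the cyclic order around v
  IsRotationSystem : (Fin n → Fin n → Fin n) → Set
  IsRotationSystem ρ =
    (∀ v u → adj G v u ≡ true → adj G v (ρ v u) ≡ true) ×
    (∀ v u w → adj G v u ≡ true → adj G v w ≡ true →
       ∃ λ k → iter (ρ v) k u ≡ w)

  -- face-tracing permutation on darts (v , u): (v,u) ↦ (u , ρ u v)
  faceStep : (Fin n → Fin n → Fin n) → Fin n × Fin n → Fin n × Fin n
  faceStep ρ (v , u) = (u , ρ u v)

  key : Fin n × Fin n → ℕ
  key (v , u) = toℕ v * n + toℕ u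

  -- a dart is the representative of its face if it has the least key
  -- in its orbit (orbits have length ≤ n * n)
  faceRep : (Fin n → Fin n → Fin n) → Fin n → Fin n → Bool
  faceRep ρ v u = adj G v u ∧
    not (anyF {n * n} (λ k → key (iter (faceStep ρ) (toℕ k) (v , u)) <ᵇ key (v , u)))

  faceCount : (Fin n → Fin n → Fin n) → ℕ
  faceCount ρ = sumF (λ v → count (faceRep ρ v))

  reach : ℕ → Fin n → Fin n → Bool
  reach zero    v w = v == w
  reach (suc k) v w = reach k v w ∨ anyF (λ u → reach k v u ∧ adj G u w)

  -- number of connected components containing at least one edge
  -- (counted by their least vertex)
  componentCount : ℕ
  componentCount = count (λ v → not (isolated v) ∧
    not (anyF (λ w → reach n v w ∧ (toℕ w <ᵇ toℕ v))))

  nonIsolatedCount : ℕ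
  nonIsolatedCount = count (λ v → not (isolated v))

  -- Sum of genera of the components (isolated vertices ignored) is ≤ 1,
  -- i.e. V' − E + F ≥ 2c' − 2 by Euler's formula.
  EmbeddableInTorus : Set
  EmbeddableInTorus = ∃ λ ρ → IsRotationSystem ρ ×
    (edgeCount + 2 * componentCount ≤ nonIsolatedCount + faceCount ρ + 2)

isOdd : ℕ → Bool
isOdd k = Data.Nat._≡ᵇ_ (k % 2) 1
  where import Data.Nat

{-# OPTIONS --safe #-}
module Submission where

-- Suppose v has degree 5 and at least two neighbours of odd degree. Deleting the five
-- edges at v one at a time keeps the graph embeddable in the torus: removing an edge ab
-- either leaves a and b connected, and then the faces through ab and ba merge, losing at
-- most one face, or it disconnects them, and then ab and ba lie on a single face, which
-- splits into one face for each new component (or isolated end); either way the bound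
-- E + 2c ≤ V + F + 2 survives. Dropping the now isolated v gives a smaller toroidal
-- graph, which has a nice colouring by minimality. Give v a colour avoiding the colours
-- of its 5 neighbours and, for each of its at most 3 even-degree neighbours u, the unique
-- colour (if any) that would make every colour class of N(u) even. This forbids at most
-- 8 of the 9 colours. Vertices of odd degree (v and its odd neighbours) satisfy the parity
-- condition for any colouring, and the remaining vertices keep their neighbourhoods, so
-- G would be nicely coloured.

open import Defs hiding (sym)
open import Data.Bool using (Bool; true; false; _∧_; _∨_; not; if_then_else_; T; _xor_)
open import Data.Bool.Properties
  using (∨-comm; ∧-comm; ∨-identityʳ; ∧-identityʳ; ∧-zeroʳ; ∧-conicalˡ; ∧-conicalʳ;
         not-involutive; ¬-not; not-distribˡ-xor)
open import Data.Nat
  using (ℕ; zero; suc; _+_; _*_; _≤_; _<_; z≤n; s≤s; _∸_; _<ᵇ_; _≡ᵇ_; _%_; _≤?_; _<?_)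
open import Data.Nat.Properties
open import Data.Nat.DivMod using ([m+n]%n≡m%n)
open import Algebra.Properties.CommutativeSemigroup +-commutativeSemigroup
  using (x∙yz≈y∙xz; interchange)
open import Data.Nat.Tactic.RingSolver using (solve-∀)
open import Data.Fin using (Fin; toℕ; punchIn; punchOut; combine; fromℕ<)
  renaming (zero to fz; suc to fs; _≟_ to _≟F_)
open import Data.Fin.Properties
  using (toℕ-injective; combine-injective; toℕ-combine; pigeonhole; toℕ-fromℕ<; toℕ<n;
         punchIn-injective; punchInᵢ≢i; punchIn-punchOut; punchIn-mono-≤; punchIn-cancel-≤)
  renaming (suc-injective to fsuc-injective; 0≢1+n to fz≢fs)
open import Data.Product using (Σ; ∃; _×_; _,_; proj₁; proj₂; uncurry)
open import Data.Sum using (_⊎_; inj₁; inj₂)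
open import Data.Empty using (⊥; ⊥-elim)
open import Data.Unit using (tt)
open import Relation.Binary.PropositionalEquality
open import Relation.Nullary using (¬_; yes; no; Dec)
open import Relation.Binary using (tri<; tri≈; tri>)

true≢false : true ≢ false
true≢false ()

∨-elim : ∀ a b → a ∨ b ≡ true → a ≡ true ⊎ b ≡ true
∨-elim true b e = inj₁ refl
∨-elim false b e = inj₂ e

∧-intro : ∀ {a b} → a ≡ true → b ≡ true → a ∧ b ≡ true
∧-intro refl refl = refl

∨-introˡ : ∀ {a} b → a ≡ true → a ∨ b ≡ true
∨-introˡ b refl = refl

∨-introʳ : ∀ a {b} → b ≡ true → a ∨ b ≡ true
∨-introʳ true e = refl
∨-introʳ false e = e

not≡true⇒≡false : ∀ {a} → not a ≡ true → a ≡ false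
not≡true⇒≡false {false} e = refl

not≡false⇒≡true : ∀ {a} → not a ≡ false → a ≡ true
not≡false⇒≡true {true} e = refl

≡false⇒not≡true : ∀ {a} → a ≡ false → not a ≡ true
≡false⇒not≡true refl = refl

≡false⇒∧≡false : ∀ {a} b → a ≡ false → a ∧ b ≡ false
≡false⇒∧≡false b refl = refl

≡true-ext : ∀ {a b : Bool} → (a ≡ true → b ≡ true) → (b ≡ true → a ≡ true) → a ≡ b
≡true-ext {true} {b} h1 h2 = sym (h1 refl)
≡true-ext {false} {true} h1 h2 = h2 refl
≡true-ext {false} {false} h1 h2 = refl

∧-cong-if : ∀ {x x′ y y′ : Bool} → x ≡ x′ → (x′ ≡ true → y ≡ y′) → x ∧ y ≡ x′ ∧ y′
∧-cong-if {x′ = true} refl h = h refl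
∧-cong-if {x′ = false} refl h = refl

≡ᵇ⇒≡′ : ∀ m n → (m ≡ᵇ n) ≡ true → m ≡ n
≡ᵇ⇒≡′ m n e = ≡ᵇ⇒≡ m n (subst T (sym e) tt)

≡ᵇ-refl : ∀ m → (m ≡ᵇ m) ≡ true
≡ᵇ-refl zero = refl
≡ᵇ-refl (suc m) = ≡ᵇ-refl m

<ᵇ⇒<′ : ∀ m n → (m <ᵇ n) ≡ true → m < n
<ᵇ⇒<′ m n e = <ᵇ⇒< m n (subst T (sym e) tt)

<⇒<ᵇ′ : ∀ {m n} → m < n → (m <ᵇ n) ≡ true
<⇒<ᵇ′ {m} {n} lt with m <ᵇ n in e
... | true = refl
... | false = ⊥-elim (subst T e (<⇒<ᵇ lt))

<ᵇ≡false⇒≥ : ∀ m n → (m <ᵇ n) ≡ false → n ≤ m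
<ᵇ≡false⇒≥ m n e = ≮⇒≥ (λ lt → true≢false (trans (sym (<⇒<ᵇ′ lt)) e))

==⇒≡ : ∀ {n} (a b : Fin n) → (a == b) ≡ true → a ≡ b
==⇒≡ a b e = toℕ-injective (≡ᵇ⇒≡′ (toℕ a) (toℕ b) e)

==-refl : ∀ {n} (a : Fin n) → (a == a) ≡ true
==-refl a = ≡ᵇ-refl (toℕ a)

≢⇒==false : ∀ {n} (a b : Fin n) → a ≢ b → (a == b) ≡ false
≢⇒==false a b ne = ¬-not (λ e → ne (==⇒≡ a b e))

==-sym : ∀ {n} (a b : Fin n) → (a == b) ≡ (b == a)
==-sym a b = ≡true-ext (λ t → subst (λ z → (z == a) ≡ true) (==⇒≡ a b t) (==-refl a))
                       (λ t → subst (λ z → (z == b) ≡ true) (==⇒≡ b a t) (==-refl b))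

ind : Bool → ℕ
ind b = if b then 1 else 0

anyF⇒∃ : ∀ {n} (p : Fin n → Bool) → anyF p ≡ true → ∃ λ i → p i ≡ true
anyF⇒∃ {zero} p ()
anyF⇒∃ {suc n} p e with p fz in eq
... | true = fz , eq
... | false with anyF⇒∃ (λ i → p (fs i)) e
... | i , q = fs i , q

∃⇒anyF : ∀ {n} (p : Fin n → Bool) i → p i ≡ true → anyF p ≡ true
∃⇒anyF p fz e rewrite e = refl
∃⇒anyF p (fs i) e rewrite ∃⇒anyF (λ i → p (fs i)) i e = ∨-comm (p fz) true

∀⇒anyF≡false : ∀ {n} (p : Fin n → Bool) → (∀ i → p i ≡ false) → anyF p ≡ false
∀⇒anyF≡false {zero} p h = refl
∀⇒anyF≡false {suc n} p h rewrite h fz = ∀⇒anyF≡false (λ i → p (fs i)) (λ i → h (fs i))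

anyF≡false⇒∀ : ∀ {n} (p : Fin n → Bool) → anyF p ≡ false → ∀ i → p i ≡ false
anyF≡false⇒∀ p e i with p i in eq
... | false = refl
... | true = subst (_≡ false) (∃⇒anyF p i eq) e

anyF-cong : ∀ {n} (p q : Fin n → Bool) → (∀ i → p i ≡ q i) → anyF p ≡ anyF q
anyF-cong {zero} p q h = refl
anyF-cong {suc n} p q h = cong₂ _∨_ (h fz) (anyF-cong _ _ (λ i → h (fs i)))

count-cong : ∀ {n} (p q : Fin n → Bool) → (∀ i → p i ≡ q i) → count p ≡ count q
count-cong {zero} p q h = refl
count-cong {suc n} p q h = cong₂ (λ a b → ind a + b) (h fz) (count-cong _ _ (λ i → h (fs i)))

count-mono : ∀ {n} (p q : Fin n → Bool) → (∀ i → p i ≡ true → q i ≡ true) → count p ≤ count q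
count-mono {zero} p q h = z≤n
count-mono {suc n} p q h with p fz in e1 | q fz in e2
... | true | true = s≤s (count-mono _ _ (λ i → h (fs i)))
... | true | false = ⊥-elim (true≢false (trans (sym (h fz e1)) e2))
... | false | true = ≤-trans (count-mono _ _ (λ i → h (fs i))) (n≤1+n _)
... | false | false = count-mono _ _ (λ i → h (fs i))

count-≤ : ∀ {n} (p : Fin n → Bool) → count p ≤ n
count-≤ {zero} p = z≤n
count-≤ {suc n} p with p fz
... | true = s≤s (count-≤ _)
... | false = ≤-trans (count-≤ _) (n≤1+n _)

count-mono-< : ∀ {n} (p q : Fin n → Bool) → (∀ i → p i ≡ true → q i ≡ true) →
  ∀ j → p j ≡ false → q j ≡ true → count p < count q
count-mono-< {suc n} p q h fz pj qj rewrite pj | qj = s≤s (count-mono _ _ (λ i → h (fs i)))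
count-mono-< {suc n} p q h (fs j) pj qj with p fz in e1 | q fz in e2
... | true | true = s≤s (count-mono-< _ _ (λ i → h (fs i)) j pj qj)
... | true | false = ⊥-elim (true≢false (trans (sym (h fz e1)) e2))
... | false | true = ≤-trans (count-mono-< _ _ (λ i → h (fs i)) j pj qj) (n≤1+n _)
... | false | false = count-mono-< _ _ (λ i → h (fs i)) j pj qj

count-split : ∀ {n} (p q : Fin n → Bool) →
  count p ≡ count (λ i → p i ∧ q i) + count (λ i → p i ∧ not (q i))
count-split {zero} p q = refl
count-split {suc n} p q with p fz | q fz | count-split (λ i → p (fs i)) (λ i → q (fs i))
... | true | true | ih = cong suc ih
... | true | false | ih = trans (cong suc ih) (sym (+-suc _ _))
... | false | true | ih = ih
... | false | false | ih = ih

count-∨ : ∀ {n} (p q : Fin n → Bool) → count (λ i → p i ∨ q i) ≤ count p + count q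
count-∨ {zero} p q = z≤n
count-∨ {suc n} p q with p fz | q fz | count-∨ (λ i → p (fs i)) (λ i → q (fs i))
... | true | true | ih = s≤s (≤-trans ih (≤-trans (m≤n+m _ 1) (≤-reflexive (sym (+-suc _ _)))))
... | true | false | ih = s≤s ih
... | false | true | ih = ≤-trans (s≤s ih) (≤-reflexive (sym (+-suc _ _)))
... | false | false | ih = ih

count≡0 : ∀ {n} (p : Fin n → Bool) → (∀ i → p i ≡ false) → count p ≡ 0
count≡0 {zero} p h = refl
count≡0 {suc n} p h rewrite h fz = count≡0 _ (λ i → h (fs i))

count-∃ : ∀ {n} (p : Fin n → Bool) → 1 ≤ count p → ∃ λ i → p i ≡ true
count-∃ {zero} p ()
count-∃ {suc n} p h with p fz in e
... | true = fz , e
... | false with count-∃ (λ i → p (fs i)) h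
... | i , q = fs i , q

count-≥1 : ∀ {n} (p : Fin n → Bool) i → p i ≡ true → 1 ≤ count p
count-≥1 {suc n} p fz e rewrite e = s≤s z≤n
count-≥1 {suc n} p (fs i) e with p fz
... | true = s≤s z≤n
... | false = count-≥1 _ i e

count≡0⇒ : ∀ {n} (p : Fin n → Bool) → count p ≡ 0 → ∀ x → p x ≡ false
count≡0⇒ p e x = ¬-not (λ t → 1+n≰n (subst (1 ≤_) e (count-≥1 p x t)))

count<n⇒∃ : ∀ {n} (p : Fin n → Bool) → count p < n → ∃ λ i → p i ≡ false
count<n⇒∃ {zero} p ()
count<n⇒∃ {suc n} p h with p fz in e
... | false = fz , e
... | true with count<n⇒∃ (λ i → p (fs i)) (≤-pred h)
... | i , q = fs i , q

count-≤1 : ∀ {n} (p : Fin n → Bool) → (∀ i j → p i ≡ true → p j ≡ true → i ≡ j) → count p ≤ 1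
count-≤1 {zero} p h = z≤n
count-≤1 {suc n} p h with p fz in e
... | true = ≤-reflexive (cong suc (count≡0 _ rest))
  where rest : ∀ i → p (fs i) ≡ false
        rest i = ¬-not (λ e2 → fz≢fs (h fz (fs i) e e2))
... | false = count-≤1 _ (λ i j a b → fsuc-injective (h (fs i) (fs j) a b))

count-== : ∀ {n} (u₀ : Fin n) → count (λ u → u == u₀) ≡ 1
count-== u₀ = ≤-antisym
  (count-≤1 (λ u → u == u₀) (λ i j ei ej → trans (==⇒≡ _ _ ei) (sym (==⇒≡ _ _ ej))))
  (count-≥1 (λ u → u == u₀) u₀ (==-refl u₀))

count-addPoint : ∀ {n} (p : Fin n → Bool) (c : Fin n) (γ : Bool) → (γ ≡ true → p c ≡ false) →
  count (λ x → p x ∨ ((x == c) ∧ γ)) ≡ count p + ind γ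
count-addPoint p c false h =
  trans (count-cong _ p (λ x → trans (cong (p x ∨_) (∧-zeroʳ (x == c))) (∨-identityʳ (p x))))
        (sym (+-identityʳ _))
count-addPoint p c true h =
  trans (count-split (λ x → p x ∨ ((x == c) ∧ true)) (λ x → x == c))
        (trans (cong₂ _+_ atC offC) (+-comm 1 _))
  where
  atC : count (λ x → (p x ∨ ((x == c) ∧ true)) ∧ (x == c)) ≡ 1
  atC = trans (count-cong _ (λ x → x == c) lem) (count-== c)
    where lem : ∀ x → ((p x ∨ ((x == c) ∧ true)) ∧ (x == c)) ≡ (x == c)
          lem x with x == c | p x
          ... | true | true = refl
          ... | true | false = refl
          ... | false | true = refl
          ... | false | false = refl
  offC : count (λ x → (p x ∨ ((x == c) ∧ true)) ∧ not (x == c)) ≡ count p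
  offC = count-cong _ p lem
    where lem : ∀ x → ((p x ∨ ((x == c) ∧ true)) ∧ not (x == c)) ≡ p x
          lem x with x == c in e | p x in e2
          ... | false | true = refl
          ... | false | false = refl
          ... | true | false = refl
          ... | true | true rewrite ==⇒≡ x c e = sym (trans (sym e2) (h refl))

count-≤-+1 : ∀ {n} (p q : Fin n → Bool) →
  (∀ x y → q x ≡ true → p x ≡ false → q y ≡ true → p y ≡ false → x ≡ y) →
  count q ≤ count p + 1
count-≤-+1 p q h =
  ≤-trans (count-mono q (λ x → p x ∨ (q x ∧ not (p x))) cover)
    (≤-trans (count-∨ p (λ x → q x ∧ not (p x)))
             (+-monoʳ-≤ (count p) (count-≤1 (λ x → q x ∧ not (p x)) unique)))
  where
  cover : ∀ x → q x ≡ true → (p x ∨ (q x ∧ not (p x))) ≡ true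
  cover x e with p x
  ... | true = refl
  ... | false rewrite e = refl
  unique : ∀ i j → (q i ∧ not (p i)) ≡ true → (q j ∧ not (p j)) ≡ true → i ≡ j
  unique i j ei ej = h i j (∧-conicalˡ _ _ ei) (not≡true⇒≡false (∧-conicalʳ _ _ ei))
                           (∧-conicalˡ _ _ ej) (not≡true⇒≡false (∧-conicalʳ _ _ ej))

count-punchIn : ∀ {m} (v : Fin (suc m)) (p : Fin (suc m) → Bool) →
  count p ≡ ind (p v) + count (λ x → p (punchIn v x))
count-punchIn fz p = refl
count-punchIn {suc m} (fs v) p =
  trans (cong (ind (p fz) +_) (count-punchIn v (λ i → p (fs i))))
        (x∙yz≈y∙xz (ind (p fz)) (ind (p (fs v))) (count (λ x → p (fs (punchIn v x)))))

anyF-punchIn : ∀ {m} (v : Fin (suc m)) (p : Fin (suc m) → Bool) →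
  anyF p ≡ p v ∨ anyF (λ x → p (punchIn v x))
anyF-punchIn fz p = refl
anyF-punchIn {suc m} (fs v) p with p fz
... | true = sym (∨-comm (p (fs v)) true)
... | false = anyF-punchIn v (λ i → p (fs i))

sumF-cong : ∀ {n} (f g : Fin n → ℕ) → (∀ i → f i ≡ g i) → sumF f ≡ sumF g
sumF-cong {zero} f g h = refl
sumF-cong {suc n} f g h = cong₂ _+_ (h fz) (sumF-cong _ _ (λ i → h (fs i)))

sumF-mono : ∀ {n} (f g : Fin n → ℕ) → (∀ i → f i ≤ g i) → sumF f ≤ sumF g
sumF-mono {zero} f g h = z≤n
sumF-mono {suc n} f g h = +-mono-≤ (h fz) (sumF-mono _ _ (λ i → h (fs i)))

sumF-+ : ∀ {n} (f g : Fin n → ℕ) → sumF (λ i → f i + g i) ≡ sumF f + sumF g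
sumF-+ {zero} f g = refl
sumF-+ {suc n} f g rewrite sumF-+ (λ i → f (fs i)) (λ i → g (fs i)) =
  interchange (f fz) (g fz) (sumF (λ i → f (fs i))) (sumF (λ i → g (fs i)))

sumF≡0 : ∀ {n} (f : Fin n → ℕ) → (∀ i → f i ≡ 0) → sumF f ≡ 0
sumF≡0 {zero} f h = refl
sumF≡0 {suc n} f h rewrite h fz = sumF≡0 _ (λ i → h (fs i))

sumF-∃ : ∀ {n} (f : Fin n → ℕ) → 1 ≤ sumF f → ∃ λ i → 1 ≤ f i
sumF-∃ {zero} f ()
sumF-∃ {suc n} f h with f fz in e
... | suc k = fz , subst (1 ≤_) (sym e) (s≤s z≤n)
... | zero with sumF-∃ (λ i → f (fs i)) h
... | i , q = fs i , q

f≤sumF : ∀ {n} (f : Fin n → ℕ) i → f i ≤ sumF f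
f≤sumF {suc n} f fz = m≤m+n _ _
f≤sumF {suc n} f (fs i) = ≤-trans (f≤sumF (λ i → f (fs i)) i) (m≤n+m _ _)

sumF-punchIn : ∀ {m} (v : Fin (suc m)) (f : Fin (suc m) → ℕ) →
  sumF f ≡ f v + sumF (λ x → f (punchIn v x))
sumF-punchIn fz f = refl
sumF-punchIn {suc m} (fs v) f =
  trans (cong (f fz +_) (sumF-punchIn v (λ i → f (fs i))))
        (x∙yz≈y∙xz (f fz) (f (fs v)) (sumF (λ x → f (fs (punchIn v x)))))

sumF-ind : ∀ {n} (p : Fin n → Bool) → sumF (λ v → ind (p v)) ≡ count p
sumF-ind {zero} p = refl
sumF-ind {suc n} p = cong (ind (p fz) +_) (sumF-ind (λ i → p (fs i)))

count-anyF : ∀ {n k} (B : Fin n → Fin k → Bool) →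
  count (λ i → anyF (λ u → B u i)) ≤ sumF (λ u → count (B u))
count-anyF {zero} {k} B = ≤-reflexive (count≡0 {k} (λ i → false) (λ i → refl))
count-anyF {suc n} B = ≤-trans (count-∨ (B fz) (λ i → anyF (λ u → B (fs u) i)))
                               (+-monoʳ-≤ (count (B fz)) (count-anyF (λ u → B (fs u))))

module _ {n : ℕ} where

  Pred₂ : Set
  Pred₂ = Fin n → Fin n → Bool

  count₂ : Pred₂ → ℕ
  count₂ p = sumF (λ v → count (p v))

  count₂-cong : ∀ (p q : Pred₂) → (∀ v u → p v u ≡ q v u) → count₂ p ≡ count₂ q
  count₂-cong p q h = sumF-cong _ _ (λ v → count-cong (p v) (q v) (h v))

  count₂-mono : ∀ (p q : Pred₂) → (∀ v u → p v u ≡ true → q v u ≡ true) → count₂ p ≤ count₂ q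
  count₂-mono p q h = sumF-mono _ _ (λ v → count-mono (p v) (q v) (h v))

  count₂-split : ∀ (p q : Pred₂) →
    count₂ p ≡ count₂ (λ v u → p v u ∧ q v u) + count₂ (λ v u → p v u ∧ not (q v u))
  count₂-split p q = trans (sumF-cong _ _ (λ v → count-split (p v) (q v)))
                           (sumF-+ (λ v → count (λ u → p v u ∧ q v u)) (λ v → count (λ u → p v u ∧ not (q v u))))

  count₂-∨ : ∀ (p q : Pred₂) → count₂ (λ v u → p v u ∨ q v u) ≤ count₂ p + count₂ q
  count₂-∨ p q = ≤-trans (sumF-mono _ _ (λ v → count-∨ (p v) (q v)))
                         (≤-reflexive (sumF-+ (λ v → count (p v)) (λ v → count (q v))))

  count₂-≥1 : ∀ (p : Pred₂) v u → p v u ≡ true → 1 ≤ count₂ p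
  count₂-≥1 p v u e = ≤-trans (count-≥1 (p v) u e) (f≤sumF (λ v → count (p v)) v)

  count₂-∃ : ∀ (p : Pred₂) → 1 ≤ count₂ p → ∃ λ v → ∃ λ u → p v u ≡ true
  count₂-∃ p h with sumF-∃ (λ v → count (p v)) h
  ... | v , h2 with count-∃ (p v) h2
  ... | u , e = v , u , e

  count₂-== : ∀ v₀ u₀ → count₂ (λ v u → (v == v₀) ∧ (u == u₀)) ≡ 1
  count₂-== v₀ u₀ = trans (sumF-cong _ _ row) (trans (sumF-ind (λ v → v == v₀)) (count-== v₀))
    where row : ∀ v → count (λ u → (v == v₀) ∧ (u == u₀)) ≡ ind (v == v₀)
          row v with v == v₀
          ... | true = count-== u₀
          ... | false = count≡0 {n} (λ u → false) (λ _ → refl)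

  count₂-≤1 : ∀ (p : Pred₂) → (∀ v u v′ u′ → p v u ≡ true → p v′ u′ ≡ true → v ≡ v′ × u ≡ u′) →
    count₂ p ≤ 1
  count₂-≤1 p h with count₂ p in eq
  ... | zero = z≤n
  ... | suc k with count₂-∃ p (subst (1 ≤_) (sym eq) (s≤s z≤n))
  ... | v₀ , u₀ , e₀ = subst (_≤ 1) eq (≤-trans (count₂-mono p _ onlyOne) (≤-reflexive (count₂-== v₀ u₀)))
    where onlyOne : ∀ v u → p v u ≡ true → ((v == v₀) ∧ (u == u₀)) ≡ true
          onlyOne v u e with h v u v₀ u₀ e e₀
          ... | refl , refl = ∧-intro (==-refl v) (==-refl u)

  count₂-≥2 : ∀ (p : Pred₂) v₁ u₁ v₂ u₂ → p v₁ u₁ ≡ true → p v₂ u₂ ≡ true →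
    ¬ (v₁ ≡ v₂ × u₁ ≡ u₂) → 2 ≤ count₂ p
  count₂-≥2 p v₁ u₁ v₂ u₂ e₁ e₂ ne = subst (2 ≤_) (sym (count₂-split p first))
      (+-mono-≤ (count₂-≥1 _ v₁ u₁ (∧-intro e₁ (∧-intro (==-refl v₁) (==-refl u₁))))
                (count₂-≥1 _ v₂ u₂ (∧-intro e₂ (≡false⇒not≡true (¬-not λ t →
                   ne (sym (==⇒≡ v₂ v₁ (∧-conicalˡ _ _ t)) , sym (==⇒≡ u₂ u₁ (∧-conicalʳ _ _ t))))))))
    where first = λ v u → (v == v₁) ∧ (u == u₁)

-- Walks and connected components

data Walk {n} (A : Fin n → Fin n → Bool) (x : Fin n) : Fin n → Set where
  here : Walk A x x
  step : ∀ {y z} → Walk A x y → A y z ≡ true → Walk A x z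

walk-++ : ∀ {n} {A : Fin n → Fin n → Bool} {x y z} → Walk A x y → Walk A y z → Walk A x z
walk-++ w here = w
walk-++ w (step w′ e) = step (walk-++ w w′) e

walk-sym : ∀ {n} {A : Fin n → Fin n → Bool} → (∀ u v → A u v ≡ A v u) →
  ∀ {x y} → Walk A x y → Walk A y x
walk-sym s here = here
walk-sym s (step w e) = walk-++ (step here (trans (s _ _) e)) (walk-sym s w)

walk-map : ∀ {n} {A B : Fin n → Fin n → Bool} → (∀ u v → A u v ≡ true → B u v ≡ true) →
  ∀ {x y} → Walk A x y → Walk B x y
walk-map h here = here
walk-map h (step w e) = step (walk-map h w) (h _ _ e)

walk-first : ∀ {n} {A : Fin n → Fin n → Bool} {x y} → Walk A x y → x ≢ y → ∃ λ z → A x z ≡ true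
walk-first here ne = ⊥-elim (ne refl)
walk-first {x = x} (step {y′} w e) ne with x ≟F y′
... | yes refl = _ , e
... | no ne′ = walk-first w ne′

walk-from-isolated : ∀ {n} {A : Fin n → Fin n → Bool} {x y} → (∀ z → A x z ≡ false) →
  Walk A x y → y ≡ x
walk-from-isolated h here = refl
walk-from-isolated h (step w e) with walk-from-isolated h w
... | refl = ⊥-elim (true≢false (trans (sym e) (h _)))

module Components {n : ℕ} (G : SimpleGraph n) where

  Connected : Fin n → Fin n → Set
  Connected = Walk (adj G)

  reach⇒walk : ∀ k v w → reach G k v w ≡ true → Connected v w
  reach⇒walk zero v w e rewrite ==⇒≡ v w e = here
  reach⇒walk (suc k) v w e with ∨-elim (reach G k v w) _ e
  ... | inj₁ e1 = reach⇒walk k v w e1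
  ... | inj₂ e2 with anyF⇒∃ _ e2
  ... | u , e3 = step (reach⇒walk k v u (∧-conicalˡ _ _ e3)) (∧-conicalʳ _ _ e3)

  reach-mono : ∀ k j v w → k ≤ j → reach G k v w ≡ true → reach G j v w ≡ true
  reach-mono k j v w le e with m≤n⇒∃[o]m+o≡n le
  ... | o , refl = go o
    where go : ∀ o → reach G (k + o) v w ≡ true
          go zero rewrite +-identityʳ k = e
          go (suc o) rewrite +-suc k o = ∨-introˡ _ (go o)

  walk⇒reach-some : ∀ {v w} → Connected v w → ∃ λ k → reach G k v w ≡ true
  walk⇒reach-some {v} here = 0 , ==-refl v
  walk⇒reach-some (step {y} w e) with walk⇒reach-some w
  ... | k , r = suc k , ∨-introʳ _ (∃⇒anyF _ y (∧-intro r e))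

  Stable : Fin n → ℕ → Set
  Stable v k = ∀ j w → reach G j v w ≡ true → reach G k v w ≡ true

  stable-step : ∀ v k → (∀ w → reach G (suc k) v w ≡ true → reach G k v w ≡ true) → Stable v k
  stable-step v k h zero w e = reach-mono 0 k v w z≤n e
  stable-step v k h (suc j) w e with ∨-elim (reach G j v w) _ e
  ... | inj₁ e1 = stable-step v k h j w e1
  ... | inj₂ e2 with anyF⇒∃ _ e2
  ... | u , e3 = h w (∨-introʳ _ (∃⇒anyF _ u (∧-intro (stable-step v k h j u (∧-conicalˡ _ _ e3))
                                                      (∧-conicalʳ _ _ e3))))

  -- Until reach stabilises, each step adds a vertex; there are only n of them.
  stable-or-grows : ∀ v k → Stable v k ⊎ (suc k ≤ count (reach G k v))
  stable-or-grows v zero = inj₂ (count-≥1 _ v (==-refl v))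
  stable-or-grows v (suc k) with stable-or-grows v k
  ... | inj₁ st = inj₁ (λ j w e → ∨-introˡ _ (st j w e))
  ... | inj₂ c with anyF (λ w → reach G (suc k) v w ∧ not (reach G k v w)) in eq
  ... | true with anyF⇒∃ (λ w → reach G (suc k) v w ∧ not (reach G k v w)) eq
  ... | w , e = inj₂ (≤-trans (s≤s c) (count-mono-< (reach G k v) _ (λ w → ∨-introˡ _) w
                        (not≡true⇒≡false (∧-conicalʳ _ _ e)) (∧-conicalˡ _ _ e)))
  stable-or-grows v (suc k) | inj₂ c | false =
    inj₁ (λ j w e → ∨-introˡ _ (stable-step v k noNew j w e))
    where noNew : ∀ w → reach G (suc k) v w ≡ true → reach G k v w ≡ true
          noNew w e = ¬-not (λ e2 → true≢false
            (trans (sym (∃⇒anyF _ w (∧-intro e (≡false⇒not≡true e2)))) eq))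

  stable-at-n : ∀ v → Stable v n
  stable-at-n v with stable-or-grows v n
  ... | inj₁ st = st
  ... | inj₂ c = ⊥-elim (<⇒≱ c (count-≤ _))

  walk⇒reach : ∀ {v w} → Connected v w → reach G n v w ≡ true
  walk⇒reach {v} {w} c with walk⇒reach-some c
  ... | k , r = stable-at-n v k w r

  nonIsolated⇒adj : ∀ v → isolated G v ≡ false → ∃ λ u → adj G v u ≡ true
  nonIsolated⇒adj v e = anyF⇒∃ _ (trans (sym (not-involutive (anyF (adj G v)))) (cong not e))

  adj⇒nonIsolated : ∀ v u → adj G v u ≡ true → isolated G v ≡ false
  adj⇒nonIsolated v u e = cong not (∃⇒anyF (adj G v) u e)

  isComponentRep : Fin n → Bool
  isComponentRep v = not (isolated G v) ∧ not (anyF (λ w → reach G n v w ∧ (toℕ w <ᵇ toℕ v)))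

  componentRep⇒ : ∀ v → isComponentRep v ≡ true →
    (∃ λ u → adj G v u ≡ true) × (∀ w → Connected v w → toℕ v ≤ toℕ w)
  componentRep⇒ v e =
    nonIsolated⇒adj v (not≡true⇒≡false (∧-conicalˡ _ _ e)) ,
    λ w c → <ᵇ≡false⇒≥ _ _ (lem (walk⇒reach c)
              (anyF≡false⇒∀ _ (not≡true⇒≡false (∧-conicalʳ _ _ e)) w))
    where
    lem : ∀ {a b} → a ≡ true → a ∧ b ≡ false → b ≡ false
    lem refl e = e

  ⇒componentRep : ∀ v u → adj G v u ≡ true → (∀ w → Connected v w → toℕ v ≤ toℕ w) →
    isComponentRep v ≡ true
  ⇒componentRep v u e h rewrite adj⇒nonIsolated v u e =
    ≡false⇒not≡true (∀⇒anyF≡false _ (λ w → lem w))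
    where lem : ∀ w → (reach G n v w ∧ (toℕ w <ᵇ toℕ v)) ≡ false
          lem w with reach G n v w in r
          ... | false = refl
          ... | true with toℕ w <ᵇ toℕ v in l
          ... | false = refl
          ... | true = ⊥-elim (<⇒≱ (<ᵇ⇒<′ _ _ l) (h w (reach⇒walk n v w r)))

  ¬componentRep⇒ : ∀ v u → adj G v u ≡ true → isComponentRep v ≡ false →
    ∃ λ w → toℕ w < toℕ v × Connected v w
  ¬componentRep⇒ v u e r with isolated G v | adj⇒nonIsolated v u e
  ... | .false | refl with anyF⇒∃ (λ w → reach G n v w ∧ (toℕ w <ᵇ toℕ v)) (not≡false⇒≡true r)
  ... | w , ew = w , <ᵇ⇒<′ _ _ (∧-conicalʳ _ _ ew) , reach⇒walk n v w (∧-conicalˡ _ _ ew)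

-- Face orbits of a rotation system

iter-+ : ∀ {A : Set} (f : A → A) a b x → iter f (a + b) x ≡ iter f a (iter f b x)
iter-+ f zero b x = refl
iter-+ f (suc a) b x = cong f (iter-+ f a b x)

iter-sucʳ : ∀ {A : Set} (f : A → A) k x → iter f (suc k) x ≡ iter f k (f x)
iter-sucʳ f k x = trans (cong (λ z → iter f z x) (+-comm 1 k)) (iter-+ f k 1 x)

iter-comm : ∀ {A : Set} (f : A → A) a b x → iter f a (iter f b x) ≡ iter f b (iter f a x)
iter-comm f a b x =
  trans (sym (iter-+ f a b x)) (trans (cong (λ z → iter f z x) (+-comm a b)) (iter-+ f b a x))

iter-cong : ∀ {A : Set} (f g : A → A) → (∀ z → f z ≡ g z) → ∀ k x → iter f k x ≡ iter g k x
iter-cong f g h zero x = refl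
iter-cong f g h (suc k) x = trans (h _) (cong g (iter-cong f g h k x))

iter-below-period : ∀ {A : Set} (f : A → A) x p → 0 < p → iter f p x ≡ x →
  ∀ k → ∃ λ k′ → k′ < p × iter f k x ≡ iter f k′ x
iter-below-period f x p pos e zero = 0 , pos , refl
iter-below-period f x p pos e (suc k) with iter-below-period f x p pos e k
... | k′ , lt , q with suc k′ <? p
... | yes lt′ = suc k′ , lt′ , cong f q
... | no nlt = 0 , pos , trans (cong f q) (trans (cong (λ z → iter f z x) (sym p≡1+k′)) e)
  where p≡1+k′ : p ≡ suc k′
        p≡1+k′ = ≤-antisym (≮⇒≥ nlt) lt

argmin : (f : ℕ → ℕ) (N : ℕ) → ∃ λ k → k ≤ N × (∀ j → j ≤ N → f k ≤ f j)
argmin f zero = 0 , z≤n , λ { zero z≤n → ≤-refl }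
argmin f (suc N) with argmin f N
... | k , k≤N , h with f k ≤? f (suc N)
... | yes le = k , m≤n⇒m≤1+n k≤N , lem
  where lem : ∀ j → j ≤ suc N → f k ≤ f j
        lem j j≤ with m≤n⇒m<n∨m≡n j≤
        ... | inj₁ lt = h j (≤-pred lt)
        ... | inj₂ refl = le
... | no nle = suc N , ≤-refl , lem
  where lem : ∀ j → j ≤ suc N → f (suc N) ≤ f j
        lem j j≤ with m≤n⇒m<n∨m≡n j≤
        ... | inj₁ lt = ≤-trans (<⇒≤ (≰⇒> nle)) (h j (≤-pred lt))
        ... | inj₂ refl = ≤-refl

Dart : ℕ → Set
Dart n = Fin n × Fin n

_≟D_ : ∀ {n} (d e : Dart n) → Dec (d ≡ e)
(x , y) ≟D (x′ , y′) with x ≟F x′ | y ≟F y′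
... | yes refl | yes refl = yes refl
... | no ne | _ = no (λ q → ne (cong proj₁ q))
... | yes _ | no ne = no (λ q → ne (cong proj₂ q))

module FaceOrbits {n : ℕ} (G : SimpleGraph n) (ρ : Fin n → Fin n → Fin n)
  (rs : IsRotationSystem G ρ) where

  σ : Dart n → Dart n
  σ = faceStep G ρ

  IsDart : Dart n → Set
  IsDart (v , u) = adj G v u ≡ true

  σ-dart : ∀ d → IsDart d → IsDart (σ d)
  σ-dart (v , u) e = proj₁ rs u v (trans (SimpleGraph.sym G u v) e)

  iter-dart : ∀ k d → IsDart d → IsDart (iter σ k d)
  iter-dart zero d e = e
  iter-dart (suc k) d e = σ-dart _ (iter-dart k d e)

  orbit-walk : ∀ d k → IsDart d → Walk (adj G) (proj₁ d) (proj₁ (iter σ k d))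
  orbit-walk d zero ed = here
  orbit-walk d (suc k) ed = step (orbit-walk d k ed) (iter-dart k d ed)

  ρ-injective : ∀ v x y → adj G v x ≡ true → adj G v y ≡ true → ρ v x ≡ ρ v y → x ≡ y
  ρ-injective v x y ex ey eq with proj₂ rs v (ρ v x) x (proj₁ rs v x ex) ex | proj₂ rs v x y ex ey
  ... | k , ek | i , ei =
    begin
      x                                   ≡⟨ sym ek ⟩
      iter (ρ v) k (ρ v x)                ≡⟨ cong (iter (ρ v) k) eq ⟩
      iter (ρ v) k (ρ v y)                ≡⟨ sym (iter-sucʳ (ρ v) k y) ⟩
      iter (ρ v) (suc k) y                ≡⟨ cong (iter (ρ v) (suc k)) (sym ei) ⟩
      iter (ρ v) (suc k) (iter (ρ v) i x) ≡⟨ iter-comm (ρ v) (suc k) i x ⟩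
      iter (ρ v) i (iter (ρ v) (suc k) x) ≡⟨ cong (iter (ρ v) i) (trans (iter-sucʳ (ρ v) k x) ek) ⟩
      iter (ρ v) i x                      ≡⟨ ei ⟩
      y                                   ∎
    where open ≡-Reasoning

  σ-injective : ∀ d e → IsDart d → IsDart e → σ d ≡ σ e → d ≡ e
  σ-injective (v , u) (v′ , u′) ed ee eq with cong proj₁ eq
  ... | refl = cong (_, u) (ρ-injective u v v′ (trans (SimpleGraph.sym G u v) ed)
                                               (trans (SimpleGraph.sym G u v′) ee) (cong proj₂ eq))

  iter-cancel : ∀ i j d → IsDart d → iter σ i d ≡ iter σ (j + i) d → iter σ j d ≡ d
  iter-cancel zero j d e eq rewrite +-identityʳ j = sym eq
  iter-cancel (suc i) j d e eq =
    iter-cancel i j d e (σ-injective _ _ (iter-dart i d e) (iter-dart (j + i) d e)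
                           (trans eq (cong (λ z → iter σ z d) (+-suc j i))))

  period : ∀ d → IsDart d → ∃ λ p → 0 < p × p ≤ n * n × iter σ p d ≡ d
  period d e with pigeonhole (n<1+n (n * n)) (λ k → uncurry combine (iter σ (toℕ k) d))
  ... | i , j , i<j , eq with combine-injective _ _ _ _ eq
  ... | e1 , e2 =
    toℕ j ∸ toℕ i , m<n⇒0<n∸m i<j , ≤-trans (m∸n≤m (toℕ j) (toℕ i)) (≤-pred (toℕ<n j)) ,
    iter-cancel (toℕ i) (toℕ j ∸ toℕ i) d e
      (trans (cong₂ _,_ e1 e2) (cong (λ z → iter σ z d) (sym (m∸n+n≡m (<⇒≤ i<j)))))

  iter-below-n² : ∀ d → IsDart d → ∀ k → ∃ λ k′ → k′ < n * n × iter σ k d ≡ iter σ k′ d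
  iter-below-n² d e k with period d e
  ... | p , pos , le , ep with iter-below-period σ d p pos ep k
  ... | k′ , lt , q = k′ , ≤-trans lt le , q

  Orbit : Dart n → Dart n → Set
  Orbit d e = ∃ λ k → iter σ k d ≡ e

  orbit-trans : ∀ {d e f} → Orbit d e → Orbit e f → Orbit d f
  orbit-trans {d} (k , refl) (j , refl) = j + k , iter-+ σ j k d

  orbit-sym : ∀ {d e} → IsDart d → Orbit d e → Orbit e d
  orbit-sym {d} ed (k , refl) with period d ed
  ... | p , pos , le , ep with iter-below-period σ d p pos ep k
  ... | k′ , lt , q = p ∸ k′ , (begin
        iter σ (p ∸ k′) (iter σ k d)  ≡⟨ cong (iter σ (p ∸ k′)) q ⟩
        iter σ (p ∸ k′) (iter σ k′ d) ≡⟨ sym (iter-+ σ (p ∸ k′) k′ d) ⟩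
        iter σ (p ∸ k′ + k′) d        ≡⟨ cong (λ z → iter σ z d) (m∸n+n≡m (<⇒≤ lt)) ⟩
        iter σ p d                    ≡⟨ ep ⟩
        d                             ∎)
    where open ≡-Reasoning

  orbit-σ : ∀ d → Orbit d (σ d)
  orbit-σ d = 1 , refl

  key≡combine : ∀ v u → key G (v , u) ≡ toℕ (combine v u)
  key≡combine v u = trans (cong (_+ toℕ u) (*-comm (toℕ v) n)) (sym (toℕ-combine v u))

  key-injective : ∀ d e → key G d ≡ key G e → d ≡ e
  key-injective (v , u) (v′ , u′) eq
    with combine-injective v u v′ u′ (toℕ-injective (trans (sym (key≡combine v u)) (trans eq (key≡combine v′ u′))))
  ... | refl , refl = refl

  IsFaceRep : Dart n → Set
  IsFaceRep d = IsDart d × (∀ k → key G d ≤ key G (iter σ k d))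

  faceRep⇒ : ∀ v u → faceRep G ρ v u ≡ true → IsFaceRep (v , u)
  faceRep⇒ v u e = ed , minimal
    where
    ed = ∧-conicalˡ _ _ e
    none = not≡true⇒≡false (∧-conicalʳ _ _ e)
    minimal : ∀ k → key G (v , u) ≤ key G (iter σ k (v , u))
    minimal k with iter-below-n² (v , u) ed k
    ... | k′ , lt , q = subst (λ z → key G (v , u) ≤ key G z) (sym q)
        (<ᵇ≡false⇒≥ _ _ (trans (cong (λ z → key G (iter σ z (v , u)) <ᵇ key G (v , u)) (sym (toℕ-fromℕ< lt)))
           (anyF≡false⇒∀ _ none (fromℕ< lt))))

  ⇒faceRep : ∀ v u → IsFaceRep (v , u) → faceRep G ρ v u ≡ true
  ⇒faceRep v u (ed , h) rewrite ed = ≡false⇒not≡true (∀⇒anyF≡false _ λ i → lem i)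
    where lem : ∀ (i : Fin (n * n)) → (key G (iter σ (toℕ i) (v , u)) <ᵇ key G (v , u)) ≡ false
          lem i = ¬-not (λ t → <⇒≱ (<ᵇ⇒<′ _ _ t) (h (toℕ i)))

  faceRep-unique : ∀ d r1 r2 → IsDart d → Orbit d r1 → Orbit d r2 → IsFaceRep r1 → IsFaceRep r2 → r1 ≡ r2
  faceRep-unique d r1 r2 ed o1 o2 (e1 , h1) (e2 , h2)
    with orbit-trans (orbit-sym ed o1) o2 | orbit-trans (orbit-sym ed o2) o1
  ... | (k , refl) | (j , q) =
    key-injective _ _ (≤-antisym (h1 k) (subst (λ z → key G (iter σ k r1) ≤ key G z) q (h2 j)))

  faceRep-exists : ∀ d → IsDart d → ∃ λ r → Orbit d r × IsFaceRep r
  faceRep-exists d ed with argmin (λ k → key G (iter σ k d)) (n * n)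
  ... | k₀ , k₀≤ , h = iter σ k₀ d , (k₀ , refl) , iter-dart k₀ d ed , minimal
    where minimal : ∀ j → key G (iter σ k₀ d) ≤ key G (iter σ j (iter σ k₀ d))
          minimal j with iter-below-n² d ed (j + k₀)
          ... | k′ , lt , q = subst (λ z → key G (iter σ k₀ d) ≤ key G z)
                                    (trans (sym q) (iter-+ σ j k₀ d)) (h k′ (<⇒≤ lt))

  _==D_ : Dart n → Dart n → Bool
  (a , b) ==D (c , d) = (a == c) ∧ (b == d)

  orbitᵇ : Dart n → Dart n → Bool
  orbitᵇ d e = anyF {n * n} (λ k → iter σ (toℕ k) d ==D e)

  orbitᵇ⇒ : ∀ d e → orbitᵇ d e ≡ true → Orbit d e
  orbitᵇ⇒ d e t with anyF⇒∃ {n * n} (λ k → iter σ (toℕ k) d ==D e) t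
  ... | k , q = toℕ k , cong₂ _,_ (==⇒≡ _ _ (∧-conicalˡ _ _ q)) (==⇒≡ _ _ (∧-conicalʳ _ _ q))

  ⇒orbitᵇ : ∀ d e → IsDart d → Orbit d e → orbitᵇ d e ≡ true
  ⇒orbitᵇ d e ed (k , refl) with iter-below-n² d ed k
  ... | k′ , lt , q = ∃⇒anyF _ (fromℕ< lt) (subst (λ z → iter σ (toℕ (fromℕ< lt)) d ==D z ≡ true)
         (sym q) (subst (λ z → iter σ (toℕ (fromℕ< lt)) d ==D iter σ z d ≡ true) (toℕ-fromℕ< lt)
           (==D-refl (iter σ (toℕ (fromℕ< lt)) d))))
    where ==D-refl : ∀ d → (d ==D d) ≡ true
          ==D-refl (a , b) = ∧-intro (==-refl a) (==-refl b)

-- Deleting an edge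

skip : ∀ {n} → (Fin n → Fin n) → Fin n → Fin n → Fin n
skip f o y = if f y == o then f (f y) else f y

skip-hit : ∀ {n} (f : Fin n → Fin n) o y → f y ≡ o → skip f o y ≡ f (f y)
skip-hit f o y e rewrite e | ==-refl o = refl

skip-miss : ∀ {n} (f : Fin n → Fin n) o y → f y ≢ o → skip f o y ≡ f y
skip-miss f o y ne rewrite ≢⇒==false (f y) o ne = refl

module SkipInCycle {n} (N : Fin n → Bool) (f : Fin n → Fin n) (o : Fin n)
  (No : N o ≡ true) (f-closed : ∀ x → N x ≡ true → N (f x) ≡ true)
  (f-cyclic : ∀ x y → N x ≡ true → N y ≡ true → ∃ λ k → iter f k x ≡ y) where

  N∖o : Fin n → Bool
  N∖o x = N x ∧ not (x == o)

  N∖o⇒ : ∀ x → N∖o x ≡ true → N x ≡ true × x ≢ o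
  N∖o⇒ x e = ∧-conicalˡ _ _ e ,
    λ q → true≢false (trans (sym (subst (λ z → (z == o) ≡ true) (sym q) (==-refl o)))
                            (not≡true⇒≡false (∧-conicalʳ _ _ e)))

  ⇒N∖o : ∀ x → N x ≡ true → x ≢ o → N∖o x ≡ true
  ⇒N∖o x e ne = ∧-intro e (≡false⇒not≡true (≢⇒==false x o ne))

  fo≢o : ∀ x → N x ≡ true → x ≢ o → f o ≢ o
  fo≢o x Nx ne eq with f-cyclic o x No Nx
  ... | k , ek = ne (trans (sym ek) (fixed k))
    where fixed : ∀ k → iter f k o ≡ o
          fixed zero = refl
          fixed (suc k) = trans (cong f (fixed k)) eq

  skip-closed : ∀ x → N∖o x ≡ true → N∖o (skip f o x) ≡ true
  skip-closed x e with N∖o⇒ x e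
  ... | Nx , x≢o with f x ≟F o
  ... | yes eq = subst (λ z → N∖o z ≡ true) (sym (skip-hit f o x eq))
         (⇒N∖o _ (f-closed _ (f-closed _ Nx)) (λ q → fo≢o x Nx x≢o (trans (cong f (sym eq)) q)))
  ... | no ne = subst (λ z → N∖o z ≡ true) (sym (skip-miss f o x ne)) (⇒N∖o _ (f-closed x Nx) ne)

  skip-catches-up : ∀ x → x ≢ o → f o ≢ o → ∀ j →
    (iter f j x ≢ o → ∃ λ k → iter (skip f o) k x ≡ iter f j x) ×
    (iter f j x ≡ o → ∃ λ k → iter (skip f o) k x ≡ iter f (suc j) x)
  skip-catches-up x x≢o fo zero = (λ _ → 0 , refl) , (λ eq → ⊥-elim (x≢o eq))
  skip-catches-up x x≢o fo (suc j) with skip-catches-up x x≢o fo j | iter f j x ≟F o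
  ... | miss , _ | no y≢o with miss y≢o
  ... | k , ek = (λ fy≢o → suc k , trans (cong (skip f o) ek) (skip-miss f o _ fy≢o)) ,
                 (λ fy≡o → suc k , trans (cong (skip f o) ek) (skip-hit f o _ fy≡o))
  skip-catches-up x x≢o fo (suc j) | _ , hit | yes y≡o with hit y≡o
  ... | k , ek = (λ _ → k , ek) , (λ fy≡o → ⊥-elim (fo (trans (cong f (sym y≡o)) fy≡o)))

  skip-cyclic : ∀ x y → N∖o x ≡ true → N∖o y ≡ true → ∃ λ k → iter (skip f o) k x ≡ y
  skip-cyclic x y ex ey with N∖o⇒ x ex | N∖o⇒ y ey
  ... | Nx , x≢o | Ny , y≢o with f-cyclic x y Nx Ny
  ... | j , ej with proj₁ (skip-catches-up x x≢o (fo≢o x Nx x≢o) j) (λ q → y≢o (trans (sym ej) q))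
  ... | k , ek = k , trans ek ej

-- Arithmetic of the bound E + 2c ≤ V + F + 2 when one edge is deleted: E, V, F, c count edges,
-- non-isolated vertices, faces and components before the deletion, primes after it, and X, Y
-- count the new and the old faces through the deleted edge.

torusBound-nonBridge : ∀ E′ c V F F′ X Y → suc E′ + 2 * c ≤ V + F + 2 → F + X ≡ F′ + Y →
  1 ≤ X → Y ≤ 2 → E′ + 2 * c ≤ V + F′ + 2
torusBound-nonBridge E′ c V F F′ X Y h fe x1 y2 =
  ≤-pred (≤-trans h (≤-trans (+-monoˡ-≤ 2 (+-monoʳ-≤ V F≤F′+1)) (≤-reflexive (shift V F′))))
  where
  F+1≤F′+2 : F + 1 ≤ F′ + 2
  F+1≤F′+2 = ≤-trans (+-monoʳ-≤ F x1) (≤-trans (≤-reflexive fe) (+-monoʳ-≤ F′ y2))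
  F≤F′+1 : F ≤ F′ + 1
  F≤F′+1 = ≤-pred (subst₂ _≤_ (+-comm F 1) (trans (+-comm F′ 2) (cong suc (+-comm 1 F′))) F+1≤F′+2)
  shift : ∀ V F′ → V + (F′ + 1) + 2 ≡ suc (V + F′ + 2)
  shift = solve-∀

torusBound-bridge : ∀ E′ c c′ V V′ F F′ X Y α β → suc E′ + 2 * c ≤ V + F + 2 → F + X ≡ F′ + Y →
  2 ≤ X + α + β → Y ≤ 1 → V ≡ V′ + α + β → c′ + α + β ≤ c + 1 → E′ + 2 * c′ ≤ V′ + F′ + 2
torusBound-bridge E′ c c′ V V′ F F′ X Y α β h fe x2 y1 ve ce =
  +-cancelʳ-≤ K (E′ + 2 * c′) (V′ + F′ + 2) (subst₂ _≤_ lhs rhs (+-mono-≤ (+-mono-≤ faces comps) h′))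
  where
  K = F + 2 * c + 2 * (α + β) + 2
  faces+1 : F + 2 ≤ F′ + 1 + (α + β)
  faces+1 = begin
      F + 2             ≤⟨ +-monoʳ-≤ F (subst (2 ≤_) (+-assoc X α β) x2) ⟩
      F + (X + (α + β)) ≡⟨ sym (+-assoc F X (α + β)) ⟩
      F + X + (α + β)   ≡⟨ cong (_+ (α + β)) fe ⟩
      F′ + Y + (α + β)  ≤⟨ +-monoˡ-≤ (α + β) (+-monoʳ-≤ F′ y1) ⟩
      F′ + 1 + (α + β)  ∎
    where open ≤-Reasoning
  faces : F + 1 ≤ F′ + (α + β)
  faces = ≤-pred (subst₂ _≤_ (e1 F) (e2 F′ (α + β)) faces+1)
    where e1 : ∀ F → F + 2 ≡ suc (F + 1)
          e1 = solve-∀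
          e2 : ∀ F′ s → F′ + 1 + s ≡ suc (F′ + s)
          e2 = solve-∀
  comps : 2 * c′ + 2 * (α + β) ≤ 2 * c + 2
  comps = subst₂ _≤_ (e c′ α β) (e′ c) (*-monoʳ-≤ 2 ce)
    where e : ∀ c′ α β → 2 * (c′ + α + β) ≡ 2 * c′ + 2 * (α + β)
          e = solve-∀
          e′ : ∀ c → 2 * (c + 1) ≡ 2 * c + 2
          e′ = solve-∀
  h′ : suc E′ + 2 * c ≤ V′ + (α + β) + F + 2
  h′ = subst (λ z → suc E′ + 2 * c ≤ z + F + 2) (trans ve (+-assoc V′ α β)) h
  lhs : F + 1 + (2 * c′ + 2 * (α + β)) + (suc E′ + 2 * c) ≡ E′ + 2 * c′ + K
  lhs = e F c′ α β E′ c
    where e : ∀ F c′ α β E′ c → F + 1 + (2 * c′ + 2 * (α + β)) + (suc E′ + 2 * c)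
                              ≡ E′ + 2 * c′ + (F + 2 * c + 2 * (α + β) + 2)
          e = solve-∀
  rhs : F′ + (α + β) + (2 * c + 2) + (V′ + (α + β) + F + 2) ≡ V′ + F′ + 2 + K
  rhs = e F′ α β c V′ F
    where e : ∀ F′ α β c V′ F → F′ + (α + β) + (2 * c + 2) + (V′ + (α + β) + F + 2)
                              ≡ V′ + F′ + 2 + (F + 2 * c + 2 * (α + β) + 2)
          e = solve-∀

module EdgeDeletion {n : ℕ} (G : SimpleGraph n) (ρ : Fin n → Fin n → Fin n)
  (rs : IsRotationSystem G ρ) (a b : Fin n) (eab : adj G a b ≡ true) where

  a≢b : a ≢ b
  a≢b eq = true≢false (trans (sym eab) (trans (cong (adj G a) (sym eq)) (irrefl G a)))

  eba : adj G b a ≡ true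
  eba = trans (SimpleGraph.sym G b a) eab

  isAB : Fin n → Fin n → Bool
  isAB x y = ((x == a) ∧ (y == b)) ∨ ((x == b) ∧ (y == a))

  isAB-sym : ∀ x y → isAB x y ≡ isAB y x
  isAB-sym x y = trans (∨-comm ((x == a) ∧ (y == b)) ((x == b) ∧ (y == a)))
                       (cong₂ _∨_ (∧-comm (x == b) (y == a)) (∧-comm (x == a) (y == b)))

  adj′ : Fin n → Fin n → Bool
  adj′ x y = adj G x y ∧ not (isAB x y)

  G′ : SimpleGraph n
  G′ = record
    { adj = adj′
    ; sym = λ x y → cong₂ (λ p q → p ∧ not q) (SimpleGraph.sym G x y) (isAB-sym x y)
    ; irrefl = λ v → cong (_∧ not (isAB v v)) (irrefl G v) }

  ρ′ : Fin n → Fin n → Fin n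
  ρ′ y x = if y == a then skip (ρ a) b x else (if y == b then skip (ρ b) a x else ρ y x)

  b==a : (b == a) ≡ false
  b==a = ≢⇒==false b a (λ q → a≢b (sym q))

  a==b : (a == b) ≡ false
  a==b = ≢⇒==false a b a≢b

  ρ′-a : ∀ x → ρ′ a x ≡ skip (ρ a) b x
  ρ′-a x rewrite ==-refl a = refl

  ρ′-b : ∀ x → ρ′ b x ≡ skip (ρ b) a x
  ρ′-b x rewrite b==a | ==-refl b = refl

  ρ′-other : ∀ y x → y ≢ a → y ≢ b → ρ′ y x ≡ ρ y x
  ρ′-other y x na nb rewrite ≢⇒==false y a na | ≢⇒==false y b nb = refl

  isAB-a : ∀ x → isAB a x ≡ (x == b)
  isAB-a x rewrite ==-refl a | a==b = ∨-identityʳ (x == b)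

  isAB-b : ∀ x → isAB b x ≡ (x == a)
  isAB-b x rewrite ==-refl b | b==a = refl

  isAB-other : ∀ y x → y ≢ a → y ≢ b → isAB y x ≡ false
  isAB-other y x na nb rewrite ≢⇒==false y a na | ≢⇒==false y b nb = refl

  isAB⇒ : ∀ x y → isAB x y ≡ true → (x , y) ≡ (a , b) ⊎ (x , y) ≡ (b , a)
  isAB⇒ x y e with ∨-elim ((x == a) ∧ (y == b)) _ e
  ... | inj₁ e1 = inj₁ (cong₂ _,_ (==⇒≡ _ _ (∧-conicalˡ _ _ e1)) (==⇒≡ _ _ (∧-conicalʳ _ _ e1)))
  ... | inj₂ e2 = inj₂ (cong₂ _,_ (==⇒≡ _ _ (∧-conicalˡ _ _ e2)) (==⇒≡ _ _ (∧-conicalʳ _ _ e2)))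

  adj′-a : ∀ x → adj′ a x ≡ (adj G a x ∧ not (x == b))
  adj′-a x = cong (λ z → adj G a x ∧ not z) (isAB-a x)

  adj′-b : ∀ x → adj′ b x ≡ (adj G b x ∧ not (x == a))
  adj′-b x = cong (λ z → adj G b x ∧ not z) (isAB-b x)

  adj′-other : ∀ y x → y ≢ a → y ≢ b → adj′ y x ≡ adj G y x
  adj′-other y x na nb = trans (cong (λ z → adj G y x ∧ not z) (isAB-other y x na nb)) (∧-identityʳ _)

  adj′⇒adj : ∀ x y → adj′ x y ≡ true → adj G x y ≡ true
  adj′⇒adj x y = ∧-conicalˡ _ _

  module SkipA = SkipInCycle (adj G a) (ρ a) b eab (proj₁ rs a) (proj₂ rs a)
  module SkipB = SkipInCycle (adj G b) (ρ b) a eba (proj₁ rs b) (proj₂ rs b)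

  rs′ : IsRotationSystem G′ ρ′
  rs′ = closed , cyclic
    where
    closed : ∀ v u → adj′ v u ≡ true → adj′ v (ρ′ v u) ≡ true
    closed v u e with v ≟F a | v ≟F b
    ... | yes refl | _ = subst (λ z → adj′ a z ≡ true) (sym (ρ′-a u))
          (trans (adj′-a _) (SkipA.skip-closed u (trans (sym (adj′-a u)) e)))
    ... | no na | yes refl = subst (λ z → adj′ b z ≡ true) (sym (ρ′-b u))
          (trans (adj′-b _) (SkipB.skip-closed u (trans (sym (adj′-b u)) e)))
    ... | no na | no nb = trans (adj′-other v _ na nb)
          (subst (λ z → adj G v z ≡ true) (sym (ρ′-other v u na nb))
                 (proj₁ rs v u (trans (sym (adj′-other v u na nb)) e)))
    cyclic : ∀ v u w → adj′ v u ≡ true → adj′ v w ≡ true → ∃ λ k → iter (ρ′ v) k u ≡ w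
    cyclic v u w eu ew with v ≟F a | v ≟F b
    ... | yes refl | _ with SkipA.skip-cyclic u w (trans (sym (adj′-a u)) eu) (trans (sym (adj′-a w)) ew)
    ... | k , ek = k , trans (iter-cong _ _ ρ′-a k u) ek
    cyclic v u w eu ew | no na | yes refl
      with SkipB.skip-cyclic u w (trans (sym (adj′-b u)) eu) (trans (sym (adj′-b w)) ew)
    ... | k , ek = k , trans (iter-cong _ _ ρ′-b k u) ek
    cyclic v u w eu ew | no na | no nb
      with proj₂ rs v u w (trans (sym (adj′-other v u na nb)) eu) (trans (sym (adj′-other v w na nb)) ew)
    ... | k , ek = k , trans (iter-cong _ _ (λ z → ρ′-other v z na nb) k u) ek

  module F = FaceOrbits G ρ rs
  module F′ = FaceOrbits G′ ρ′ rs′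

  σ σ′ : Dart n → Dart n
  σ = F.σ
  σ′ = F′.σ

  dab dba : Dart n
  dab = (a , b)
  dba = (b , a)

  σ′-same : ∀ d → σ d ≢ dab → σ d ≢ dba → σ′ d ≡ σ d
  σ′-same (x , y) n1 n2 with y ≟F a | y ≟F b
  ... | yes refl | _ = cong (a ,_) (trans (ρ′-a x) (skip-miss (ρ a) b x (λ q → n1 (cong (a ,_) q))))
  ... | no na | yes refl = cong (b ,_) (trans (ρ′-b x) (skip-miss (ρ b) a x (λ q → n2 (cong (b ,_) q))))
  ... | no na | no nb = cong (y ,_) (ρ′-other y x na nb)

  σ′-skips-ab : ∀ d → σ d ≡ dab → σ′ d ≡ σ dba
  σ′-skips-ab (x , y) eq with cong proj₁ eq | cong proj₂ eq
  ... | refl | e2 = cong (a ,_) (trans (ρ′-a x) (trans (skip-hit (ρ a) b x e2) (cong (ρ a) e2)))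

  σ′-skips-ba : ∀ d → σ d ≡ dba → σ′ d ≡ σ dab
  σ′-skips-ba (x , y) eq with cong proj₁ eq | cong proj₂ eq
  ... | refl | e2 = cong (b ,_) (trans (ρ′-b x) (trans (skip-hit (ρ b) a x e2) (cong (ρ b) e2)))

  -- The darts on the faces of G through ab or ba; all other faces survive in G′ unchanged.
  touched : Dart n → Bool
  touched d = F.orbitᵇ dab d ∨ F.orbitᵇ dba d

  touched-ab : ∀ d → F.Orbit dab d → touched d ≡ true
  touched-ab d o = ∨-introˡ _ (F.⇒orbitᵇ dab d eab o)

  touched-ba : ∀ d → F.Orbit dba d → touched d ≡ true
  touched-ba d o = ∨-introʳ (F.orbitᵇ dab d) (F.⇒orbitᵇ dba d eba o)

  touched⇒ : ∀ d → touched d ≡ true → F.Orbit dab d ⊎ F.Orbit dba d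
  touched⇒ d e with ∨-elim (F.orbitᵇ dab d) _ e
  ... | inj₁ e1 = inj₁ (F.orbitᵇ⇒ dab d e1)
  ... | inj₂ e2 = inj₂ (F.orbitᵇ⇒ dba d e2)

  touched-σ : ∀ d → touched d ≡ true → touched (σ d) ≡ true
  touched-σ d e with touched⇒ d e
  ... | inj₁ o = touched-ab _ (F.orbit-trans o (F.orbit-σ d))
  ... | inj₂ o = touched-ba _ (F.orbit-trans o (F.orbit-σ d))

  touched-σ′ : ∀ d → touched d ≡ true → touched (σ′ d) ≡ true
  touched-σ′ d e with σ d ≟D dab | σ d ≟D dba
  ... | yes q | _ = subst (λ z → touched z ≡ true) (sym (σ′-skips-ab d q)) (touched-ba _ (F.orbit-σ dba))
  ... | no _ | yes q = subst (λ z → touched z ≡ true) (sym (σ′-skips-ba d q)) (touched-ab _ (F.orbit-σ dab))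
  ... | no n1 | no n2 = subst (λ z → touched z ≡ true) (sym (σ′-same d n1 n2)) (touched-σ d e)

  touched-iter′ : ∀ k d → touched d ≡ true → touched (iter σ′ k d) ≡ true
  touched-iter′ zero d e = e
  touched-iter′ (suc k) d e = touched-σ′ _ (touched-iter′ k d e)

  iter-σ′-untouched : ∀ d → F.IsDart d → touched d ≡ false → ∀ k → iter σ′ k d ≡ iter σ k d
  iter-σ′-untouched d ed r zero = refl
  iter-σ′-untouched d ed r (suc k) = trans (cong σ′ (iter-σ′-untouched d ed r k)) (σ′-same _ n1 n2)
    where n1 : σ (iter σ k d) ≢ dab
          n1 q = true≢false (trans (sym (touched-ab d (F.orbit-sym ed (suc k , q)))) r)
          n2 : σ (iter σ k d) ≢ dba
          n2 q = true≢false (trans (sym (touched-ba d (F.orbit-sym ed (suc k , q)))) r)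

  isAB-untouched : ∀ x y → touched (x , y) ≡ false → isAB x y ≡ false
  isAB-untouched x y r = ¬-not λ t → case (isAB⇒ x y t)
    where case : (x , y) ≡ dab ⊎ (x , y) ≡ dba → ⊥
          case (inj₁ q) = true≢false (trans (sym (touched-ab dab (0 , refl))) (trans (cong touched (sym q)) r))
          case (inj₂ q) = true≢false (trans (sym (touched-ba dba (0 , refl))) (trans (cong touched (sym q)) r))

  faceRep′-untouched : ∀ v u → touched (v , u) ≡ false → faceRep G′ ρ′ v u ≡ faceRep G ρ v u
  faceRep′-untouched v u r =
    ∧-cong-if (trans (cong (λ z → adj G v u ∧ not z) (isAB-untouched v u r)) (∧-identityʳ _))
      (λ e → cong not (anyF-cong {n * n} _ _ (λ k →
         cong (λ z → key G z <ᵇ key G (v , u)) (iter-σ′-untouched (v , u) e r (toℕ k)))))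

  touched₂ : Fin n → Fin n → Bool
  touched₂ v u = touched (v , u)

  oldFaces newFaces : ℕ
  oldFaces = count₂ (λ v u → faceRep G ρ v u ∧ touched₂ v u)
  newFaces = count₂ (λ v u → faceRep G′ ρ′ v u ∧ touched₂ v u)

  faceCount-balance : faceCount G ρ + newFaces ≡ faceCount G′ ρ′ + oldFaces
  faceCount-balance = begin
    faceCount G ρ + newFaces              ≡⟨ cong (_+ newFaces) (count₂-split (faceRep G ρ) touched₂) ⟩
    oldFaces + untouched + newFaces       ≡⟨ cong (λ z → oldFaces + z + newFaces) (sym untouched-same) ⟩
    oldFaces + untouched′ + newFaces      ≡⟨ rearrange oldFaces untouched′ newFaces ⟩
    newFaces + untouched′ + oldFaces      ≡⟨ cong (_+ oldFaces) (sym (count₂-split (faceRep G′ ρ′) touched₂)) ⟩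
    faceCount G′ ρ′ + oldFaces            ∎
    where
    open ≡-Reasoning
    untouched untouched′ : ℕ
    untouched = count₂ (λ v u → faceRep G ρ v u ∧ not (touched₂ v u))
    untouched′ = count₂ (λ v u → faceRep G′ ρ′ v u ∧ not (touched₂ v u))
    rearrange : ∀ x y z → x + y + z ≡ z + y + x
    rearrange = solve-∀
    untouched-same : untouched′ ≡ untouched
    untouched-same = count₂-cong _ _ same
      where same : ∀ v u → (faceRep G′ ρ′ v u ∧ not (touched₂ v u)) ≡ (faceRep G ρ v u ∧ not (touched₂ v u))
            same v u with touched₂ v u in r
            ... | true = trans (∧-zeroʳ _) (sym (∧-zeroʳ _))
            ... | false = cong (_∧ true) (faceRep′-untouched v u r)

  faces-through-≤1 : ∀ o → F.IsDart o → count₂ (λ v u → faceRep G ρ v u ∧ F.orbitᵇ o (v , u)) ≤ 1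
  faces-through-≤1 o eo = count₂-≤1 _ unique
    where unique : ∀ v u v′ u′ → (faceRep G ρ v u ∧ F.orbitᵇ o (v , u)) ≡ true →
                   (faceRep G ρ v′ u′ ∧ F.orbitᵇ o (v′ , u′)) ≡ true → v ≡ v′ × u ≡ u′
          unique v u v′ u′ e e′
            with F.faceRep-unique o (v , u) (v′ , u′) eo
                   (F.orbitᵇ⇒ o _ (∧-conicalʳ _ _ e)) (F.orbitᵇ⇒ o _ (∧-conicalʳ _ _ e′))
                   (F.faceRep⇒ v u (∧-conicalˡ _ _ e)) (F.faceRep⇒ v′ u′ (∧-conicalˡ _ _ e′))
          ... | q = cong proj₁ q , cong proj₂ q

  oldFaces≤2 : oldFaces ≤ 2
  oldFaces≤2 =
    ≤-trans (count₂-mono _ (λ v u → through dab v u ∨ through dba v u)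
                           (λ v u e → distrib (faceRep G ρ v u) _ _ e))
      (≤-trans (count₂-∨ (through dab) (through dba))
               (+-mono-≤ (faces-through-≤1 dab eab) (faces-through-≤1 dba eba)))
    where
    through : Dart n → Fin n → Fin n → Bool
    through o v u = faceRep G ρ v u ∧ F.orbitᵇ o (v , u)
    distrib : ∀ x y z → x ∧ (y ∨ z) ≡ true → ((x ∧ y) ∨ (x ∧ z)) ≡ true
    distrib true true z e = refl
    distrib true false z e = e

  oldFaces≤1 : F.Orbit dab dba → oldFaces ≤ 1
  oldFaces≤1 ab~ba = ≤-trans (count₂-mono _ _ onFaceOfAb) (faces-through-≤1 dab eab)
    where onFaceOfAb : ∀ v u → (faceRep G ρ v u ∧ touched₂ v u) ≡ true →
                       (faceRep G ρ v u ∧ F.orbitᵇ dab (v , u)) ≡ true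
          onFaceOfAb v u e with touched⇒ (v , u) (∧-conicalʳ _ _ e)
          ... | inj₁ o = ∧-intro (∧-conicalˡ _ _ e) (F.⇒orbitᵇ dab _ eab o)
          ... | inj₂ o = ∧-intro (∧-conicalˡ _ _ e) (F.⇒orbitᵇ dab _ eab (F.orbit-trans ab~ba o))

  σba-dart′ : isolated G′ a ≡ false → adj′ a (ρ a b) ≡ true
  σba-dart′ e with Components.nonIsolated⇒adj G′ a e
  ... | x , ex with SkipA.N∖o⇒ x (trans (sym (adj′-a x)) ex)
  ... | Nx , x≢b = trans (adj′-a _) (SkipA.⇒N∖o _ (proj₁ rs a b eab) (SkipA.fo≢o x Nx x≢b))

  σab-dart′ : isolated G′ b ≡ false → adj′ b (ρ b a) ≡ true
  σab-dart′ e with Components.nonIsolated⇒adj G′ b e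
  ... | x , ex with SkipB.N∖o⇒ x (trans (sym (adj′-b x)) ex)
  ... | Nx , x≢a = trans (adj′-b _) (SkipB.⇒N∖o _ (proj₁ rs b a eba) (SkipB.fo≢o x Nx x≢a))

  touched-rep′ : ∀ e → F′.IsDart e → touched e ≡ true →
    ∃ λ r → F′.Orbit e r × faceRep G′ ρ′ (proj₁ r) (proj₂ r) ≡ true × touched r ≡ true
  touched-rep′ e ed te with F′.faceRep-exists e ed
  ... | (v , u) , (k , q) , isRep =
    (v , u) , (k , q) , F′.⇒faceRep v u isRep , subst (λ z → touched z ≡ true) q (touched-iter′ k e te)

  newFaces≥1 : ∀ e → F′.IsDart e → touched e ≡ true → 1 ≤ newFaces
  newFaces≥1 e ed te with touched-rep′ e ed te
  ... | (v , u) , _ , isRep , t = count₂-≥1 (λ v u → faceRep G′ ρ′ v u ∧ touched₂ v u) v u (∧-intro isRep t)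

  touched-σba : touched (σ dba) ≡ true
  touched-σba = touched-ba _ (F.orbit-σ dba)

  touched-σab : touched (σ dab) ≡ true
  touched-σab = touched-ab _ (F.orbit-σ dab)

  newFaces≥1-if-connected : Walk adj′ a b → 1 ≤ newFaces
  newFaces≥1-if-connected w with walk-first w a≢b
  ... | z , ez = newFaces≥1 (σ dba) (σba-dart′ (Components.adj⇒nonIsolated G′ a z ez)) touched-σba

  orbit-walk′ : ∀ e r → F′.IsDart e → F′.Orbit e r → Walk adj′ (proj₁ e) (proj₁ r)
  orbit-walk′ e r ed (k , q) = subst (λ z → Walk adj′ (proj₁ e) (proj₁ z)) q (F′.orbit-walk e k ed)

  -- An end of ab that is isolated in G′ counts as a face; otherwise σ′ has a touched face
  -- at each end, and these differ because a face of G′ cannot contain both a and b.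
  newFaces≥2-if-disconnected : ¬ Walk adj′ a b → 2 ≤ newFaces + ind (isolated G′ a) + ind (isolated G′ b)
  newFaces≥2-if-disconnected nw with isolated G′ a in ia | isolated G′ b in ib
  ... | true | true = ≤-trans (m≤n+m 2 newFaces) (≤-reflexive (sym (+-assoc newFaces 1 1)))
  ... | false | true =
    +-mono-≤ (≤-trans (newFaces≥1 (σ dba) (σba-dart′ ia) touched-σba) (m≤m+n newFaces 0)) (≤-refl {1})
  ... | true | false =
    ≤-trans (+-mono-≤ (newFaces≥1 (σ dab) (σab-dart′ ib) touched-σab) (≤-refl {1})) (m≤m+n (newFaces + 1) 0)
  ... | false | false with touched-rep′ (σ dba) (σba-dart′ ia) touched-σba
                         | touched-rep′ (σ dab) (σab-dart′ ib) touched-σab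
  ... | (va , ua) , oa , ra , ta | (vb , ub) , ob , rb , tb =
     ≤-trans (count₂-≥2 (λ v u → faceRep G′ ρ′ v u ∧ touched₂ v u) va ua vb ub
                        (∧-intro ra ta) (∧-intro rb tb) distinct)
             (≤-reflexive (sym (trans (+-identityʳ _) (+-identityʳ _))))
    where distinct : ¬ (va ≡ vb × ua ≡ ub)
          distinct (refl , _) = nw (walk-++ (orbit-walk′ (σ dba) (va , ua) (σba-dart′ ia) oa)
                                    (walk-sym (SimpleGraph.sym G′) (orbit-walk′ (σ dab) (va , ub) (σab-dart′ ib) ob)))

  Walk′ : Fin n → Fin n → Set
  Walk′ = Walk adj′

  walk′-sym : ∀ {x y} → Walk′ x y → Walk′ y x
  walk′-sym = walk-sym (SimpleGraph.sym G′)

  -- If ba is not on the face of ab, that face returns to ab without using ba, so its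
  -- boundary walk from b back to a avoids the deleted edge.
  face-walk′ : (∀ k → iter σ k dab ≢ dba) → Walk′ b a
  face-walk′ h with F.period dab eab
  ... | suc k′ , pos , le , ep = subst (λ z → Walk′ b (proj₁ z)) ep (along k′)
    where
    along : ∀ k → Walk′ b (proj₁ (iter σ (suc k) dab))
    along zero = here
    along (suc k) with iter σ (suc k) dab ≟D dab | iter σ (suc k) dab ≟D dba
    ... | yes q | _ = subst (λ z → Walk′ b (proj₂ z)) (sym q) here
    ... | no _ | yes q = ⊥-elim (h (suc k) q)
    ... | no n1 | no n2 = step (along k)
          (∧-intro (F.iter-dart (suc k) dab eab) (≡false⇒not≡true (¬-not λ t → notAB (isAB⇒ _ _ t))))
      where notAB : _ → ⊥
            notAB (inj₁ q) = n1 q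
            notAB (inj₂ q) = n2 q

  disconnected⇒same-face : ¬ Walk′ a b → F.Orbit dab dba
  disconnected⇒same-face nw with F.orbitᵇ dab dba in e
  ... | true = F.orbitᵇ⇒ dab dba e
  ... | false = ⊥-elim (nw (walk′-sym (face-walk′ (λ k q →
                  true≢false (trans (sym (F.⇒orbitᵇ dab dba eab (k , q))) e)))))

  edgeCount-deletion : edgeCount G ≡ suc (edgeCount G′)
  edgeCount-deletion =
    trans (count₂-split (λ u w → adj G u w ∧ less u w) isAB) (cong₂ _+_ deleted kept)
    where
    less : Fin n → Fin n → Bool
    less u w = toℕ u <ᵇ toℕ w
    swap∧ : ∀ x y z → ((x ∧ y) ∧ not z) ≡ ((x ∧ not z) ∧ y)
    swap∧ true true true = refl
    swap∧ true true false = refl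
    swap∧ true false true = refl
    swap∧ true false false = refl
    swap∧ false y z = refl
    kept : count₂ (λ u w → (adj G u w ∧ less u w) ∧ not (isAB u w)) ≡ edgeCount G′
    kept = count₂-cong _ _ (λ u w → swap∧ (adj G u w) (less u w) (isAB u w))
    P : Fin n → Fin n → Bool
    P u w = (adj G u w ∧ less u w) ∧ isAB u w
    P⇒< : ∀ v u → P v u ≡ true → toℕ v < toℕ u
    P⇒< v u e = <ᵇ⇒<′ (toℕ v) (toℕ u) (∧-conicalʳ _ (less v u) (∧-conicalˡ _ (isAB v u) e))
    unique : ∀ v u v′ u′ → P v u ≡ true → P v′ u′ ≡ true → v ≡ v′ × u ≡ u′
    unique v u v′ u′ e e′ with isAB⇒ v u (∧-conicalʳ _ _ e) | isAB⇒ v′ u′ (∧-conicalʳ _ _ e′)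
    ... | inj₁ refl | inj₁ refl = refl , refl
    ... | inj₂ refl | inj₂ refl = refl , refl
    ... | inj₁ refl | inj₂ refl = ⊥-elim (<-asym (P⇒< a b e) (P⇒< b a e′))
    ... | inj₂ refl | inj₁ refl = ⊥-elim (<-asym (P⇒< b a e) (P⇒< a b e′))
    present : 1 ≤ count₂ P
    present with <-cmp (toℕ a) (toℕ b)
    ... | tri< lt _ _ = count₂-≥1 P a b (∧-intro (∧-intro eab (<⇒<ᵇ′ lt)) (trans (isAB-a b) (==-refl b)))
    ... | tri≈ _ eq _ = ⊥-elim (a≢b (toℕ-injective eq))
    ... | tri> _ _ gt = count₂-≥1 P b a (∧-intro (∧-intro eba (<⇒<ᵇ′ gt)) (trans (isAB-b a) (==-refl a)))
    deleted : count₂ P ≡ 1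
    deleted = ≤-antisym (count₂-≤1 P unique) present

  α β : Bool
  α = isolated G′ a
  β = isolated G′ b

  isolated′-other : ∀ x → x ≢ a → x ≢ b → isolated G′ x ≡ isolated G x
  isolated′-other x na nb = cong not (anyF-cong _ _ (λ y → adj′-other x y na nb))

  nonIsolatedCount-deletion : nonIsolatedCount G ≡ nonIsolatedCount G′ + ind α + ind β
  nonIsolatedCount-deletion =
    trans (sym (count-cong withEnds _ withEnds≡))
          (trans (count-addPoint withA b β bNew)
                 (cong (_+ ind β) (count-addPoint (λ x → not (isolated G′ x)) a α (cong not))))
    where
    withA withEnds : Fin n → Bool
    withA x = not (isolated G′ x) ∨ ((x == a) ∧ α)
    withEnds x = withA x ∨ ((x == b) ∧ β)
    bNew : β ≡ true → withA b ≡ false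
    bNew e rewrite e | b==a = refl
    nonIsolated-a : not (isolated G a) ≡ true
    nonIsolated-a = cong not (Components.adj⇒nonIsolated G a b eab)
    nonIsolated-b : not (isolated G b) ≡ true
    nonIsolated-b = cong not (Components.adj⇒nonIsolated G b a eba)
    withEnds≡ : ∀ x → withEnds x ≡ not (isolated G x)
    withEnds≡ x with x ≟F a | x ≟F b
    ... | yes refl | _ = trans (cong (λ t → (not α ∨ (t ∧ α)) ∨ ((a == b) ∧ β)) (==-refl a))
                               (trans (lem α _) (sym nonIsolated-a))
      where lem : ∀ x z → (not x ∨ (true ∧ x)) ∨ z ≡ true
            lem true z = refl
            lem false z = refl
    ... | no na | yes refl = trans (cong₂ (λ t t′ → (not β ∨ (t ∧ α)) ∨ (t′ ∧ β)) b==a (==-refl b))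
                                   (trans (lem β) (sym nonIsolated-b))
      where lem : ∀ y → (not y ∨ false) ∨ (true ∧ y) ≡ true
            lem true = refl
            lem false = refl
    ... | no na | no nb =
      trans (cong₂ (λ t t′ → (not (isolated G′ x) ∨ (t ∧ α)) ∨ (t′ ∧ β)) (≢⇒==false x a na) (≢⇒==false x b nb))
            (trans (trans (∨-identityʳ _) (∨-identityʳ _)) (cong not (isolated′-other x na nb)))

  walk′⇒walk : ∀ {x y} → Walk′ x y → Components.Connected G x y
  walk′⇒walk = walk-map adj′⇒adj

  adj⇒adj′-or-ab : ∀ y z → adj G y z ≡ true → adj′ y z ≡ true ⊎ ((y , z) ≡ dab ⊎ (y , z) ≡ dba)
  adj⇒adj′-or-ab y z e with isAB y z in i
  ... | false = inj₁ (∧-intro e refl)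
  ... | true = inj₂ (isAB⇒ y z i)

  walk⇒walk′ : Walk′ a b → ∀ {x y} → Components.Connected G x y → Walk′ x y
  walk⇒walk′ wab here = here
  walk⇒walk′ wab (step {y} {z} w e) with adj⇒adj′-or-ab y z e
  ... | inj₁ e′ = step (walk⇒walk′ wab w) e′
  ... | inj₂ (inj₁ refl) = walk-++ (walk⇒walk′ wab w) wab
  ... | inj₂ (inj₂ refl) = walk-++ (walk⇒walk′ wab w) (walk′-sym wab)

  walk⇒walk′-or-end : ∀ {x y} → Components.Connected G x y → Walk′ x y ⊎ (Walk′ x a ⊎ Walk′ x b)
  walk⇒walk′-or-end here = inj₁ here
  walk⇒walk′-or-end (step {y} {z} w e) with walk⇒walk′-or-end w
  ... | inj₂ r = inj₂ r
  ... | inj₁ c with adj⇒adj′-or-ab y z e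
  ... | inj₁ e′ = inj₁ (step c e′)
  ... | inj₂ (inj₁ refl) = inj₂ (inj₁ c)
  ... | inj₂ (inj₂ refl) = inj₂ (inj₂ c)

  componentCount-nonBridge : Walk′ a b → componentCount G′ ≡ componentCount G
  componentCount-nonBridge wab = count-cong _ _ (λ x → ≡true-ext (toG x) (toG′ x))
    where
    open Components
    toG : ∀ x → isComponentRep G′ x ≡ true → isComponentRep G x ≡ true
    toG x e with componentRep⇒ G′ x e
    ... | (u , eu) , h = ⇒componentRep G x u (adj′⇒adj x u eu) (λ w c → h w (walk⇒walk′ wab c))
    toG′ : ∀ x → isComponentRep G x ≡ true → isComponentRep G′ x ≡ true
    toG′ x e with componentRep⇒ G x e
    ... | (u , eu) , h
      with walk-first (walk⇒walk′ wab (step here eu))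
                      (λ q → true≢false (trans (sym eu) (trans (cong (adj G x) (sym q)) (irrefl G x))))
    ... | z , ez = ⇒componentRep G′ x z ez (λ w c → h w (walk′⇒walk c))

  repOrIsolatedA′ repOrIsolatedEnd′ : Fin n → Bool
  repOrIsolatedA′ x = Components.isComponentRep G′ x ∨ ((x == a) ∧ α)
  repOrIsolatedEnd′ x = repOrIsolatedA′ x ∨ ((x == b) ∧ β)

  count-repOrIsolatedEnd′ : count repOrIsolatedEnd′ ≡ componentCount G′ + ind α + ind β
  count-repOrIsolatedEnd′ =
    trans (count-addPoint repOrIsolatedA′ b β bNew)
          (cong (_+ ind β) (count-addPoint (Components.isComponentRep G′) a α aNew))
    where
    aNew : α ≡ true → Components.isComponentRep G′ a ≡ false
    aNew e = cong (λ z → not z ∧ not (anyF (λ w → reach G′ n a w ∧ (toℕ w <ᵇ toℕ a)))) e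
    bNew : β ≡ true → repOrIsolatedA′ b ≡ false
    bNew e rewrite b==a =
      cong (λ z → (not z ∧ not (anyF (λ w → reach G′ n b w ∧ (toℕ w <ᵇ toℕ b)))) ∨ false) e

  repOrIsolatedEnd′⇒ : ∀ x → repOrIsolatedEnd′ x ≡ true →
    Components.isComponentRep G′ x ≡ true ⊎ ((x ≡ a × α ≡ true) ⊎ (x ≡ b × β ≡ true))
  repOrIsolatedEnd′⇒ x e with ∨-elim (repOrIsolatedA′ x) _ e
  ... | inj₂ e2 = inj₂ (inj₂ (==⇒≡ x b (∧-conicalˡ _ _ e2) , ∧-conicalʳ _ _ e2))
  ... | inj₁ e1 with ∨-elim (Components.isComponentRep G′ x) _ e1
  ... | inj₁ e3 = inj₁ e3
  ... | inj₂ e4 = inj₂ (inj₁ (==⇒≡ x a (∧-conicalˡ _ _ e4) , ∧-conicalʳ _ _ e4))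

  isolated′⇒ : ∀ c → isolated G′ c ≡ true → ∀ z → adj′ c z ≡ false
  isolated′⇒ c e = anyF≡false⇒∀ (adj G′ c) (not≡true⇒≡false e)

  repOrIsolatedEnd′-minimal : ∀ x → repOrIsolatedEnd′ x ≡ true → ∀ w → Walk′ x w → toℕ x ≤ toℕ w
  repOrIsolatedEnd′-minimal x e w c with repOrIsolatedEnd′⇒ x e
  ... | inj₁ e′ = proj₂ (Components.componentRep⇒ G′ x e′) w c
  ... | inj₂ (inj₁ (refl , ea)) rewrite walk-from-isolated (isolated′⇒ a ea) c = ≤-refl
  ... | inj₂ (inj₂ (refl , eb)) rewrite walk-from-isolated (isolated′⇒ b eb) c = ≤-refl

  repOrIsolatedEnd′-adj : ∀ x → repOrIsolatedEnd′ x ≡ true → ∃ λ u → adj G x u ≡ true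
  repOrIsolatedEnd′-adj x e with repOrIsolatedEnd′⇒ x e
  ... | inj₁ e′ with proj₁ (Components.componentRep⇒ G′ x e′)
  ... | u , eu = u , adj′⇒adj x u eu
  repOrIsolatedEnd′-adj x e | inj₂ (inj₁ (refl , _)) = b , eab
  repOrIsolatedEnd′-adj x e | inj₂ (inj₂ (refl , _)) = a , eba

  nonRep⇒smaller : ∀ x → repOrIsolatedEnd′ x ≡ true → Components.isComponentRep G x ≡ false →
    ∃ λ w → toℕ w < toℕ x × Components.Connected G x w
  nonRep⇒smaller x e c with repOrIsolatedEnd′-adj x e
  ... | u , eu = Components.¬componentRep⇒ G x u eu c

  Separated : Fin n → Fin n → Set
  Separated x w = (Walk′ x a × Walk′ w b) ⊎ (Walk′ x b × Walk′ w a)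

  nonRep-separated : ∀ x → repOrIsolatedEnd′ x ≡ true → Components.isComponentRep G x ≡ false →
    ∃ λ w → toℕ w < toℕ x × Separated x w
  nonRep-separated x e c with nonRep⇒smaller x e c
  ... | w , lt , cw = w , lt , sides (walk⇒walk′-or-end cw) (walk⇒walk′-or-end (walk-sym (SimpleGraph.sym G) cw))
    where
    apart : Walk′ x w → ⊥
    apart c′ = <⇒≱ lt (repOrIsolatedEnd′-minimal x e w c′)
    sides : Walk′ x w ⊎ (Walk′ x a ⊎ Walk′ x b) → Walk′ w x ⊎ (Walk′ w a ⊎ Walk′ w b) → Separated x w
    sides (inj₁ c′) _ = ⊥-elim (apart c′)
    sides _ (inj₁ c′) = ⊥-elim (apart (walk′-sym c′))
    sides (inj₂ (inj₁ xa)) (inj₂ (inj₁ wa)) = ⊥-elim (apart (walk-++ xa (walk′-sym wa)))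
    sides (inj₂ (inj₁ xa)) (inj₂ (inj₂ wb)) = inj₁ (xa , wb)
    sides (inj₂ (inj₂ xb)) (inj₂ (inj₁ wa)) = inj₂ (xb , wa)
    sides (inj₂ (inj₂ xb)) (inj₂ (inj₂ wb)) = ⊥-elim (apart (walk-++ xb (walk′-sym wb)))

  -- Only the component of G containing ab can split, into the parts of a and of b; the
  -- larger of the two minima is then the only new representative.
  nonRep-unique : ∀ x y → repOrIsolatedEnd′ x ≡ true → Components.isComponentRep G x ≡ false →
    repOrIsolatedEnd′ y ≡ true → Components.isComponentRep G y ≡ false → x ≡ y
  nonRep-unique x y ex cx ey cy with nonRep-separated x ex cx | nonRep-separated y ey cy
  ... | wx , ltx , sx | wy , lty , sy = decide sx sy
    where
    minimal = repOrIsolatedEnd′-minimal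
    same : Walk′ x y → x ≡ y
    same c = toℕ-injective (≤-antisym (minimal x ex y c) (minimal y ey x (walk′-sym c)))
    cross : Walk′ y wx → Walk′ x wy → ⊥
    cross c1 c2 = <-asym (≤-<-trans (minimal y ey wx c1) ltx) (≤-<-trans (minimal x ex wy c2) lty)
    decide : Separated x wx → Separated y wy → x ≡ y
    decide (inj₁ (xa , wxb)) (inj₁ (ya , wyb)) = same (walk-++ xa (walk′-sym ya))
    decide (inj₂ (xb , wxa)) (inj₂ (yb , wya)) = same (walk-++ xb (walk′-sym yb))
    decide (inj₁ (xa , wxb)) (inj₂ (yb , wya)) =
      ⊥-elim (cross (walk-++ yb (walk′-sym wxb)) (walk-++ xa (walk′-sym wya)))
    decide (inj₂ (xb , wxa)) (inj₁ (ya , wyb)) =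
      ⊥-elim (cross (walk-++ ya (walk′-sym wxa)) (walk-++ xb (walk′-sym wyb)))

  componentCount-bridge : componentCount G′ + ind α + ind β ≤ componentCount G + 1
  componentCount-bridge = subst (_≤ componentCount G + 1) count-repOrIsolatedEnd′
    (count-≤-+1 (Components.isComponentRep G) repOrIsolatedEnd′ nonRep-unique)

  torusBound′ : edgeCount G + 2 * componentCount G ≤ nonIsolatedCount G + faceCount G ρ + 2 →
    edgeCount G′ + 2 * componentCount G′ ≤ nonIsolatedCount G′ + faceCount G′ ρ′ + 2
  torusBound′ h with reach G′ n a b in r
  ... | true =
    subst (λ c → edgeCount G′ + 2 * c ≤ nonIsolatedCount G′ + faceCount G′ ρ′ + 2)
          (sym (componentCount-nonBridge wab))
      (torusBound-nonBridge (edgeCount G′) (componentCount G) (nonIsolatedCount G′)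
        (faceCount G ρ) (faceCount G′ ρ′) newFaces oldFaces
        (subst₂ (λ E V → E + 2 * componentCount G ≤ V + faceCount G ρ + 2) edgeCount-deletion V≡V′ h)
        faceCount-balance (newFaces≥1-if-connected wab) oldFaces≤2)
    where
    wab : Walk′ a b
    wab = Components.reach⇒walk G′ n a b r
    α≡false : α ≡ false
    α≡false with walk-first wab a≢b
    ... | z , ez = Components.adj⇒nonIsolated G′ a z ez
    β≡false : β ≡ false
    β≡false with walk-first (walk′-sym wab) (λ q → a≢b (sym q))
    ... | z , ez = Components.adj⇒nonIsolated G′ b z ez
    V≡V′ : nonIsolatedCount G ≡ nonIsolatedCount G′
    V≡V′ = trans nonIsolatedCount-deletion
      (trans (cong₂ (λ p q → nonIsolatedCount G′ + ind p + ind q) α≡false β≡false)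
             (trans (+-identityʳ _) (+-identityʳ _)))
  ... | false =
    torusBound-bridge (edgeCount G′) (componentCount G) (componentCount G′)
      (nonIsolatedCount G) (nonIsolatedCount G′) (faceCount G ρ) (faceCount G′ ρ′)
      newFaces oldFaces (ind α) (ind β)
      (subst (λ E → E + 2 * componentCount G ≤ nonIsolatedCount G + faceCount G ρ + 2) edgeCount-deletion h)
      faceCount-balance (newFaces≥2-if-disconnected nw) (oldFaces≤1 (disconnected⇒same-face nw))
      nonIsolatedCount-deletion componentCount-bridge
    where
    nw : ¬ Walk′ a b
    nw w = true≢false (trans (sym (Components.walk⇒reach G′ w)) r)

  degree′-a : suc (degree G′ a) ≡ degree G a
  degree′-a = sym (trans (count-split (adj G a) (isAB a)) (cong (_+ degree G′ a) deleted))
    where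
    atB : ∀ x → (adj G a x ∧ isAB a x) ≡ true → x ≡ b
    atB x e = ==⇒≡ x b (trans (sym (isAB-a x)) (∧-conicalʳ _ _ e))
    deleted : count (λ x → adj G a x ∧ isAB a x) ≡ 1
    deleted = ≤-antisym (count-≤1 _ (λ i j ei ej → trans (atB i ei) (sym (atB j ej))))
                        (count-≥1 _ b (∧-intro eab (trans (isAB-a b) (==-refl b))))

  adj′-off-a : ∀ x y → x ≢ a → y ≢ a → adj′ x y ≡ adj G x y
  adj′-off-a x y nx ny rewrite ≢⇒==false x a nx | ≢⇒==false y a ny =
    trans (cong (λ z → adj G x y ∧ not z) (∧-zeroʳ (x == b))) (∧-identityʳ _)

-- Deleting a vertex

Isolated : ∀ {n} → SimpleGraph n → Fin n → Set
Isolated G v = ∀ x → adj G v x ≡ false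

AgreeOff : ∀ {n} → Fin n → SimpleGraph n → SimpleGraph n → Set
AgreeOff v G H = ∀ x y → x ≢ v → y ≢ v → adj G x y ≡ adj H x y

isolateVertex : ∀ k {n} (G : SimpleGraph n) (v : Fin n) → degree G v ≡ k → EmbeddableInTorus G →
  Σ (SimpleGraph n) λ G₀ → EmbeddableInTorus G₀ × Isolated G₀ v × AgreeOff v G₀ G
isolateVertex zero G v deg emb = G , emb , count≡0⇒ (adj G v) deg , (λ x y _ _ → refl)
isolateVertex (suc k) G v deg (ρ , rs , h) with count-∃ (adj G v) (subst (1 ≤_) (sym deg) (s≤s z≤n))
... | b , evb
  with isolateVertex k (D.G′) v (suc-injective (trans D.degree′-a deg)) (D.ρ′ , D.rs′ , D.torusBound′ h)
  where module D = EdgeDeletion G ρ rs v b evb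
... | G₀ , emb₀ , iso₀ , agree₀ =
  G₀ , emb₀ , iso₀ , λ x y nx ny → trans (agree₀ x y nx ny) (D.adj′-off-a x y nx ny)
  where module D = EdgeDeletion G ρ rs v b evb


module _ {N : ℕ} where

  Lex : Fin N → Fin N → Fin N → Fin N → Set
  Lex a b c d = toℕ a < toℕ c ⊎ (a ≡ c × toℕ b ≤ toℕ d)

  key-< : ∀ (a b c d : Fin N) → toℕ a < toℕ c → toℕ a * N + toℕ b < toℕ c * N + toℕ d
  key-< a b c d lt = begin-strict
      toℕ a * N + toℕ b <⟨ +-monoʳ-< (toℕ a * N) (toℕ<n b) ⟩
      toℕ a * N + N     ≡⟨ +-comm (toℕ a * N) N ⟩
      suc (toℕ a) * N   ≤⟨ *-monoˡ-≤ N lt ⟩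
      toℕ c * N         ≤⟨ m≤m+n _ _ ⟩
      toℕ c * N + toℕ d ∎
    where open ≤-Reasoning

  key-≤⇒Lex : ∀ a b c d → toℕ a * N + toℕ b ≤ toℕ c * N + toℕ d → Lex a b c d
  key-≤⇒Lex a b c d le with <-cmp (toℕ a) (toℕ c)
  ... | tri< lt _ _ = inj₁ lt
  ... | tri≈ _ eq _ with toℕ-injective eq
  ... | refl = inj₂ (refl , +-cancelˡ-≤ (toℕ a * N) _ _ le)
  key-≤⇒Lex a b c d le | tri> _ _ gt = ⊥-elim (<⇒≱ (key-< c d a b gt) le)

  Lex⇒key-≤ : ∀ a b c d → Lex a b c d → toℕ a * N + toℕ b ≤ toℕ c * N + toℕ d
  Lex⇒key-≤ a b c d (inj₁ lt) = <⇒≤ (key-< a b c d lt)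
  Lex⇒key-≤ a b c d (inj₂ (refl , le)) = +-monoʳ-≤ (toℕ a * N) le

module RemoveIsolated {m : ℕ} (G : SimpleGraph (suc m)) (v : Fin (suc m)) (iso : Isolated G v) where

  lift : Fin m → Fin (suc m)
  lift = punchIn v

  -- The first argument is a junk value, returned at v itself.
  lower : Fin m → Fin (suc m) → Fin m
  lower d w with v ≟F w
  ... | yes _ = d
  ... | no ne = punchOut ne

  lift-lower : ∀ d w → w ≢ v → lift (lower d w) ≡ w
  lift-lower d w nw with v ≟F w
  ... | yes eq = ⊥-elim (nw (sym eq))
  ... | no ne = punchIn-punchOut ne

  lift≢v : ∀ x → lift x ≢ v
  lift≢v x = punchInᵢ≢i v x

  iso-to : ∀ x → adj G x v ≡ false
  iso-to x = trans (SimpleGraph.sym G x v) (iso x)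

  adj⇒≢v : ∀ x w → adj G x w ≡ true → w ≢ v
  adj⇒≢v x w e refl = true≢false (trans (sym e) (iso-to x))

  H : SimpleGraph m
  H = record
    { adj = λ x y → adj G (lift x) (lift y)
    ; sym = λ x y → SimpleGraph.sym G (lift x) (lift y)
    ; irrefl = λ x → irrefl G (lift x) }

  lift-< : ∀ x y → toℕ x < toℕ y → toℕ (lift x) < toℕ (lift y)
  lift-< x y lt = ≤∧≢⇒< (punchIn-mono-≤ v x y (<⇒≤ lt))
                        (λ q → <-irrefl (cong toℕ (punchIn-injective v x y (toℕ-injective q))) lt)

  lift-<⁻¹ : ∀ x y → toℕ (lift x) < toℕ (lift y) → toℕ x < toℕ y
  lift-<⁻¹ x y lt = ≤∧≢⇒< (punchIn-cancel-≤ v x y (<⇒≤ lt))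
                          (λ q → <-irrefl (cong (λ z → toℕ (lift z)) (toℕ-injective q)) lt)

  lift-<ᵇ : ∀ x y → (toℕ (lift x) <ᵇ toℕ (lift y)) ≡ (toℕ x <ᵇ toℕ y)
  lift-<ᵇ x y = ≡true-ext (λ t → <⇒<ᵇ′ (lift-<⁻¹ x y (<ᵇ⇒<′ _ _ t))) (λ t → <⇒<ᵇ′ (lift-< x y (<ᵇ⇒<′ _ _ t)))

  Lex-lift : ∀ a b c d → Lex a b c d → Lex (lift a) (lift b) (lift c) (lift d)
  Lex-lift a b c d (inj₁ lt) = inj₁ (lift-< a c lt)
  Lex-lift a b c d (inj₂ (refl , le)) = inj₂ (refl , punchIn-mono-≤ v b d le)

  Lex-lift⁻¹ : ∀ a b c d → Lex (lift a) (lift b) (lift c) (lift d) → Lex a b c d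
  Lex-lift⁻¹ a b c d (inj₁ lt) = inj₁ (lift-<⁻¹ a c lt)
  Lex-lift⁻¹ a b c d (inj₂ (eq , le)) with punchIn-injective v a c eq
  ... | refl = inj₂ (refl , punchIn-cancel-≤ v b d le)

  key-lift-≤ : ∀ a b c d → key H (a , b) ≤ key H (c , d) → key G (lift a , lift b) ≤ key G (lift c , lift d)
  key-lift-≤ a b c d le = Lex⇒key-≤ _ _ _ _ (Lex-lift a b c d (key-≤⇒Lex a b c d le))

  key-lift-≤⁻¹ : ∀ a b c d → key G (lift a , lift b) ≤ key G (lift c , lift d) → key H (a , b) ≤ key H (c , d)
  key-lift-≤⁻¹ a b c d le = Lex⇒key-≤ _ _ _ _ (Lex-lift⁻¹ a b c d (key-≤⇒Lex _ _ _ _ le))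

  count-lift : ∀ (p : Fin (suc m) → Bool) (q : Fin m → Bool) → p v ≡ false →
    (∀ x → p (lift x) ≡ q x) → count p ≡ count q
  count-lift p q pv h =
    trans (count-punchIn v p) (trans (cong (λ z → ind z + count (λ x → p (lift x))) pv) (count-cong _ _ h))

  count₂-lift : ∀ (P : Fin (suc m) → Fin (suc m) → Bool) (Q : Fin m → Fin m → Bool) →
    (∀ w → P v w ≡ false) → (∀ w → P w v ≡ false) → (∀ x y → P (lift x) (lift y) ≡ Q x y) →
    count₂ P ≡ count₂ Q
  count₂-lift P Q from-v to-v h = trans (sumF-punchIn v (λ u → count (P u)))
    (trans (cong (_+ sumF (λ x → count (P (lift x)))) (count≡0 (P v) from-v))
           (sumF-cong _ _ (λ x → count-lift (P (lift x)) (Q x) (to-v (lift x)) (h x))))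

  walk-lift : ∀ {x y} → Walk (adj H) x y → Walk (adj G) (lift x) (lift y)
  walk-lift here = here
  walk-lift (step w e) = step (walk-lift w) e

  walk-lower : ∀ {x w} → Walk (adj G) (lift x) w → ∃ λ y → w ≡ lift y × Walk (adj H) x y
  walk-lower here = _ , refl , here
  walk-lower {x} (step {_} {z} w e) with walk-lower w
  ... | y , refl , wh = lower x z , sym z≡ , step wh (subst (λ t → adj G (lift y) t ≡ true) (sym z≡) e)
    where z≡ : lift (lower x z) ≡ z
          z≡ = lift-lower x z (adj⇒≢v _ z e)

  edgeCount-H : edgeCount G ≡ edgeCount H
  edgeCount-H = count₂-lift (λ u w → adj G u w ∧ (toℕ u <ᵇ toℕ w)) (λ u w → adj H u w ∧ (toℕ u <ᵇ toℕ w))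
    (λ w → cong (_∧ _) (iso w)) (λ w → cong (_∧ _) (iso-to w))
    (λ x y → cong (adj G (lift x) (lift y) ∧_) (lift-<ᵇ x y))

  isolated-lift : ∀ x → isolated G (lift x) ≡ isolated H x
  isolated-lift x =
    cong not (trans (anyF-punchIn v (adj G (lift x))) (cong (_∨ anyF (adj H x)) (iso-to (lift x))))

  isolated-v : isolated G v ≡ true
  isolated-v = cong not (∀⇒anyF≡false _ iso)

  nonIsolatedCount-H : nonIsolatedCount G ≡ nonIsolatedCount H
  nonIsolatedCount-H = count-lift (λ u → not (isolated G u)) (λ u → not (isolated H u))
    (cong not isolated-v) (λ x → cong not (isolated-lift x))

  isComponentRep-lift : ∀ x → Components.isComponentRep G (lift x) ≡ Components.isComponentRep H x
  isComponentRep-lift x = ≡true-ext toH toG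
    where
    open Components
    toH : isComponentRep G (lift x) ≡ true → isComponentRep H x ≡ true
    toH e with componentRep⇒ G (lift x) e
    ... | (u , eu) , h =
      ⇒componentRep H x (lower x u) (subst (λ t → adj G (lift x) t ≡ true) (sym (lift-lower x u (adj⇒≢v _ u eu))) eu)
        (λ y c → punchIn-cancel-≤ v x y (h (lift y) (walk-lift c)))
    toG : isComponentRep H x ≡ true → isComponentRep G (lift x) ≡ true
    toG e with componentRep⇒ H x e
    ... | (u , eu) , h = ⇒componentRep G (lift x) (lift u) eu minimal
      where minimal : ∀ w → Walk (adj G) (lift x) w → toℕ (lift x) ≤ toℕ w
            minimal w c with walk-lower c
            ... | y , refl , wh = punchIn-mono-≤ v x y (h y wh)

  componentCount-H : componentCount G ≡ componentCount H
  componentCount-H = count-lift (Components.isComponentRep G) (Components.isComponentRep H)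
    (cong (_∧ not (anyF (λ w → reach G (suc m) v w ∧ (toℕ w <ᵇ toℕ v)))) (cong not isolated-v))
    isComponentRep-lift

  module Rotation (ρ : Fin (suc m) → Fin (suc m) → Fin (suc m)) (rs : IsRotationSystem G ρ) where

    ρH : Fin m → Fin m → Fin m
    ρH x y = lower x (ρ (lift x) (lift y))

    lift-ρH : ∀ x y → adj H x y ≡ true → lift (ρH x y) ≡ ρ (lift x) (lift y)
    lift-ρH x y e = lift-lower x _ (adj⇒≢v _ _ (proj₁ rs (lift x) (lift y) e))

    ρH-closed : ∀ x y → adj H x y ≡ true → adj H x (ρH x y) ≡ true
    ρH-closed x y e = subst (λ t → adj G (lift x) t ≡ true) (sym (lift-ρH x y e)) (proj₁ rs _ _ e)

    lift-iter-ρH : ∀ x y k → adj H x y ≡ true →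
      lift (iter (ρH x) k y) ≡ iter (ρ (lift x)) k (lift y) × adj H x (iter (ρH x) k y) ≡ true
    lift-iter-ρH x y zero e = refl , e
    lift-iter-ρH x y (suc k) e with lift-iter-ρH x y k e
    ... | q , e′ = trans (lift-ρH x _ e′) (cong (ρ (lift x)) q) , ρH-closed x _ e′

    rsH : IsRotationSystem H ρH
    rsH = ρH-closed , cyclic
      where cyclic : ∀ x y z → adj H x y ≡ true → adj H x z ≡ true → ∃ λ k → iter (ρH x) k y ≡ z
            cyclic x y z ey ez with proj₂ rs (lift x) (lift y) (lift z) ey ez
            ... | k , q = k , punchIn-injective v _ _ (trans (proj₁ (lift-iter-ρH x y k ey)) q)

    module FG = FaceOrbits G ρ rs
    module FH = FaceOrbits H ρH rsH

    liftD : Dart m → Dart (suc m)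
    liftD (x , y) = (lift x , lift y)

    liftD-iter : ∀ k d → FH.IsDart d → liftD (iter FH.σ k d) ≡ iter FG.σ k (liftD d)
    liftD-iter zero d e = refl
    liftD-iter (suc k) d e =
      trans (liftD-σ _ (FH.iter-dart k d e)) (cong FG.σ (liftD-iter k d e))
      where liftD-σ : ∀ d → FH.IsDart d → liftD (FH.σ d) ≡ FG.σ (liftD d)
            liftD-σ (x , y) e = cong (lift y ,_) (lift-ρH y x (trans (SimpleGraph.sym H y x) e))

    faceRep-lift : ∀ x y → faceRep G ρ (lift x) (lift y) ≡ faceRep H ρH x y
    faceRep-lift x y = ≡true-ext toH toG
      where
      back : ∀ (ed : adj H x y ≡ true) k → key G (lift x , lift y) ≤ key G (iter FG.σ k (lift x , lift y)) →
        key H (x , y) ≤ key H (iter FH.σ k (x , y))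
      back ed k h with iter FH.σ k (x , y) | liftD-iter k (x , y) ed
      ... | (c , d) | q = key-lift-≤⁻¹ x y c d (subst (λ z → key G (lift x , lift y) ≤ key G z) (sym q) h)
      fwd : ∀ (ed : adj H x y ≡ true) k → key H (x , y) ≤ key H (iter FH.σ k (x , y)) →
        key G (lift x , lift y) ≤ key G (iter FG.σ k (lift x , lift y))
      fwd ed k h with iter FH.σ k (x , y) | liftD-iter k (x , y) ed
      ... | (c , d) | q = subst (λ z → key G (lift x , lift y) ≤ key G z) q (key-lift-≤ x y c d h)
      toH : faceRep G ρ (lift x) (lift y) ≡ true → faceRep H ρH x y ≡ true
      toH t = FH.⇒faceRep x y (proj₁ r , λ k → back (proj₁ r) k (proj₂ r k))
        where r = FG.faceRep⇒ (lift x) (lift y) t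
      toG : faceRep H ρH x y ≡ true → faceRep G ρ (lift x) (lift y) ≡ true
      toG t = FG.⇒faceRep (lift x) (lift y) (proj₁ r , λ k → fwd (proj₁ r) k (proj₂ r k))
        where r = FH.faceRep⇒ x y t

    faceCount-H : faceCount G ρ ≡ faceCount H ρH
    faceCount-H = count₂-lift (faceRep G ρ) (faceRep H ρH)
      (λ w → ≡false⇒∧≡false _ (iso w)) (λ w → ≡false⇒∧≡false _ (iso-to w)) faceRep-lift

  embeddable-H : EmbeddableInTorus G → EmbeddableInTorus H
  embeddable-H (ρ , rs , h) = Rotation.ρH ρ rs , Rotation.rsH ρ rs ,
    ≤-trans (≤-reflexive (cong₂ (λ E c → E + 2 * c) (sym edgeCount-H) (sym componentCount-H)))
            (≤-trans h (≤-reflexive (cong₂ (λ V F → V + F + 2) nonIsolatedCount-H (Rotation.faceCount-H ρ rs))))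

isOdd-2+ : ∀ k → isOdd (suc (suc k)) ≡ isOdd k
isOdd-2+ k = cong (λ z → z ≡ᵇ 1) (trans (cong (_% 2) (+-comm 2 k)) ([m+n]%n≡m%n k 2))

isOdd-suc : ∀ k → isOdd (suc k) ≡ not (isOdd k)
isOdd-suc zero = refl
isOdd-suc (suc zero) = refl
isOdd-suc (suc (suc k)) = trans (isOdd-2+ (suc k)) (trans (isOdd-suc k) (cong not (sym (isOdd-2+ k))))

isOdd-+ : ∀ a b → isOdd (a + b) ≡ isOdd a xor isOdd b
isOdd-+ zero b = refl
isOdd-+ (suc a) b = trans (isOdd-suc (a + b)) (trans (cong not (isOdd-+ a b))
   (trans (not-distribˡ-xor (isOdd a) (isOdd b)) (cong (_xor isOdd b) (sym (isOdd-suc a)))))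

isOdd⇒%2≡1 : ∀ k → isOdd k ≡ true → k % 2 ≡ 1
isOdd⇒%2≡1 k e = ≡ᵇ⇒≡′ (k % 2) 1 e

sumF-even : ∀ {k} (f : Fin k → ℕ) → (∀ j → isOdd (f j) ≡ false) → isOdd (sumF f) ≡ false
sumF-even {zero} f h = refl
sumF-even {suc k} f h =
  trans (isOdd-+ (f fz) _) (cong₂ _xor_ (h fz) (sumF-even (λ j → f (fs j)) (λ j → h (fs j))))

sumF-colourClasses : ∀ {n} (p : Fin n → Bool) (c : Fin n → Fin 9) →
  sumF (λ j → count (λ w → p w ∧ (c w == j))) ≡ count p
sumF-colourClasses {zero} p c = sumF≡0 {9} (λ j → 0) (λ j → refl)
sumF-colourClasses {suc n} p c =
  trans (sumF-+ (λ j → ind (p fz ∧ (c fz == j))) (λ j → count (λ w → p (fs w) ∧ (c (fs w) == j))))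
        (cong₂ _+_ (trans (sumF-ind (λ j → p fz ∧ (c fz == j))) first)
                   (sumF-colourClasses (λ w → p (fs w)) (λ w → c (fs w))))
  where first : count (λ j → p fz ∧ (c fz == j)) ≡ ind (p fz)
        first with p fz
        ... | true = trans (count-cong _ _ (λ j → ==-sym (c fz) j)) (count-== (c fz))
        ... | false = count≡0 {9} (λ j → false) (λ j → refl)

oddColourClass : ∀ {n} (p : Fin n → Bool) (c : Fin n → Fin 9) → isOdd (count p) ≡ true →
  ∃ λ j → count (λ w → p w ∧ (c w == j)) % 2 ≡ 1
oddColourClass p c e with anyF (λ j → isOdd (count (λ w → p w ∧ (c w == j)))) in q
... | true with anyF⇒∃ {9} (λ j → isOdd (count (λ w → p w ∧ (c w == j)))) q
... | j , ej = j , isOdd⇒%2≡1 (count (λ w → p w ∧ (c w == j))) ej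
oddColourClass p c e | false = ⊥-elim (true≢false (trans (sym e) (trans (cong isOdd (sym (sumF-colourClasses p c)))
  (sumF-even {9} (λ j → count (λ w → p w ∧ (c w == j))) (anyF≡false⇒∀ {9} _ q)))))

-- Extending a nice colouring of G - v

module ColourExtension {m : ℕ} (G : SimpleGraph (suc m)) (v : Fin (suc m))
  (G₀ : SimpleGraph (suc m)) (iso₀ : Isolated G₀ v) (agree₀ : AgreeOff v G₀ G)
  (cH : Fin m → Fin 9) (niceH : NiceColouring (RemoveIsolated.H G₀ v iso₀) cH) where

  open RemoveIsolated G₀ v iso₀ using (H; lift; lift≢v)

  adjH : ∀ x y → adj H x y ≡ adj G (lift x) (lift y)
  adjH x y = agree₀ (lift x) (lift y) (lift≢v x) (lift≢v y)

  adj-lower : ∀ u (nu : v ≢ u) x → adj G u (lift x) ≡ adj H (punchOut nu) x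
  adj-lower u nu x =
    trans (cong (λ z → adj G z (lift x)) (sym (punchIn-punchOut nu))) (sym (adjH (punchOut nu) x))

  degree-lower : ∀ u (nu : v ≢ u) → adj G u v ≡ false → degree G u ≡ degree H (punchOut nu)
  degree-lower u nu uv = trans (count-punchIn v (adj G u))
    (trans (cong (λ z → ind z + count (λ x → adj G u (lift x))) uv) (count-cong _ _ (adj-lower u nu)))

  extend : Fin 9 → Fin (suc m) → Fin 9
  extend col w with v ≟F w
  ... | yes _ = col
  ... | no ne = cH (punchOut ne)

  extend-v : ∀ col → extend col v ≡ col
  extend-v col with v ≟F v
  ... | yes _ = refl
  ... | no ne = ⊥-elim (ne refl)

  extend-≢v : ∀ col w (ne : v ≢ w) → extend col w ≡ cH (punchOut ne)
  extend-≢v col w ne with v ≟F w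
  ... | yes eq = ⊥-elim (ne eq)
  ... | no ne′ = cong cH (punchIn-injective v _ _ (trans (punchIn-punchOut ne′) (sym (punchIn-punchOut ne))))

  extend-lift : ∀ col x → extend col (lift x) ≡ cH x
  extend-lift col x with v ≟F lift x
  ... | yes eq = ⊥-elim (lift≢v x (sym eq))
  ... | no ne = cong cH (punchIn-injective v _ _ (punchIn-punchOut ne))

  -- The colouring of G - v read on G; its value at v is junk.
  old : Fin (suc m) → Fin 9
  old = extend fz

  extend-old : ∀ col w → v ≢ w → extend col w ≡ old w
  extend-old col w ne = trans (extend-≢v col w ne) (sym (extend-≢v fz w ne))

  classH : Fin (suc m) → Fin 9 → ℕ
  classH u j = count (λ x → adj G u (lift x) ∧ (cH x == j))

  class-extend : ∀ col u j →
    count (λ w → adj G u w ∧ (extend col w == j)) ≡ ind (adj G u v ∧ (col == j)) + classH u j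
  class-extend col u j = trans (count-punchIn v (λ w → adj G u w ∧ (extend col w == j)))
    (cong₂ (λ a b → ind a + b) (cong (λ z → adj G u v ∧ (z == j)) (extend-v col))
           (count-cong _ _ (λ x → cong (λ z → adj G u (lift x) ∧ (z == j)) (extend-lift col x))))

  -- Colour i for v spoils u when it leaves every colour class of N(u) even.
  spoils : Fin (suc m) → Fin 9 → Bool
  spoils u i = not (anyF (λ j → isOdd (ind (i == j) + classH u j)))

  -- If i and i′ both spoil u, the class of i is even with v coloured i and also with v
  -- coloured i′ ≠ i; these differ by one.
  spoils-unique : ∀ u i i′ → spoils u i ≡ true → spoils u i′ ≡ true → i ≡ i′
  spoils-unique u i i′ si si′ with i ≟F i′
  ... | yes eq = eq
  ... | no ne = ⊥-elim (true≢false (trans (sym oddH) evenH))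
    where
    evens : ∀ i′ → spoils u i′ ≡ true → ∀ j → isOdd (ind (i′ == j) + classH u j) ≡ false
    evens i′ s = anyF≡false⇒∀ _ (not≡true⇒≡false s)
    oddH : isOdd (classH u i) ≡ true
    oddH = not≡false⇒≡true (trans (sym (isOdd-suc (classH u i)))
             (subst (λ z → isOdd (ind z + classH u i) ≡ false) (==-refl i) (evens i si i)))
    evenH : isOdd (classH u i) ≡ false
    evenH = subst (λ z → isOdd (ind z + classH u i) ≡ false) (≢⇒==false i′ i (λ q → ne (sym q))) (evens i′ si′ i)

  even : Fin (suc m) → Bool
  even u = not (isOdd (degree G u))

  forbids : Fin (suc m) → Fin 9 → Bool
  forbids u i = adj G v u ∧ ((i == old u) ∨ (even u ∧ spoils u i))

  forbidden : Fin 9 → Bool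
  forbidden i = anyF (λ u → forbids u i)

  count-forbids : ∀ u → count (forbids u) ≤ ind (adj G v u) + ind (adj G v u ∧ even u)
  count-forbids u with adj G v u
  ... | false = z≤n
  ... | true = ≤-trans (count-∨ (λ i → i == old u) (λ i → even u ∧ spoils u i))
                       (+-mono-≤ (≤-reflexive (count-== (old u))) spoilers)
    where spoilers : count (λ i → even u ∧ spoils u i) ≤ ind (even u)
          spoilers with even u
          ... | false = z≤n
          ... | true = count-≤1 (spoils u) (spoils-unique u)

  count-forbidden : count forbidden ≤ degree G v + count (λ u → adj G v u ∧ even u)
  count-forbidden = ≤-trans (count-anyF forbids) (≤-trans (sumF-mono _ _ count-forbids)
    (≤-reflexive (trans (sumF-+ (λ u → ind (adj G v u)) (λ u → ind (adj G v u ∧ even u)))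
                        (cong₂ _+_ (sumF-ind (adj G v)) (sumF-ind (λ u → adj G v u ∧ even u))))))

  module Allowed (vOdd : isOdd (degree G v) ≡ true) (col : Fin 9) (allowed : forbidden col ≡ false) where

    c : Fin (suc m) → Fin 9
    c = extend col

    allowed-at : ∀ u → adj G v u ≡ true → ((col == old u) ≡ false) × ((even u ∧ spoils u col) ≡ false)
    allowed-at u e = split (anyF≡false⇒∀ (λ u → forbids u col) allowed u)
      where split : forbids u col ≡ false → ((col == old u) ≡ false) × ((even u ∧ spoils u col) ≡ false)
            split h rewrite e with col == old u
            ... | false = refl , h

    differs : ∀ u → adj G v u ≡ true → v ≢ u → c v ≢ c u
    differs u e ne q = true≢false (trans (sym (subst (λ z → (z == old u) ≡ true) (sym same) (==-refl (old u))))
                                         (proj₁ (allowed-at u e)))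
      where same : col ≡ old u
            same = trans (sym (extend-v col)) (trans q (extend-old col u ne))

    proper : Proper G c
    proper x y e = cases x y e (v ≟F x) (v ≟F y)
      where
      cases : ∀ x y → adj G x y ≡ true → Dec (v ≡ x) → Dec (v ≡ y) → c x ≢ c y
      cases x y e (yes refl) (yes refl) _ = true≢false (trans (sym e) (irrefl G v))
      cases x y e (yes refl) (no ny) = differs y e ny
      cases x y e (no nx) (yes refl) = λ q → differs x (trans (SimpleGraph.sym G v x) e) nx (sym q)
      cases x y e (no nx) (no ny) = λ q →
        proj₁ niceH (punchOut nx) (punchOut ny) eH (trans (sym (extend-≢v col x nx)) (trans q (extend-≢v col y ny)))
        where eH : adj H (punchOut nx) (punchOut ny) ≡ true
              eH = trans (adjH _ _) (trans (cong₂ (adj G) (punchIn-punchOut nx) (punchIn-punchOut ny)) e)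

    OddAt : Fin (suc m) → Set
    OddAt u = ∃ λ j → count (λ w → adj G u w ∧ (c w == j)) % 2 ≡ 1

    odd-evenNeighbour : ∀ u → even u ≡ true → adj G v u ≡ true → OddAt u
    odd-evenNeighbour u ev avu with anyF⇒∃ (λ j → isOdd (ind (col == j) + classH u j))
                                    (not≡false⇒≡true (subst (λ z → (z ∧ spoils u col) ≡ false) ev (proj₂ (allowed-at u avu))))
    ... | j , oj = j , isOdd⇒%2≡1 (count (λ w → adj G u w ∧ (c w == j))) (subst (λ z → isOdd z ≡ true)
                         (sym (trans (class-extend col u j) (cong (λ z → ind (z ∧ (col == j)) + classH u j) auv))) oj)
      where auv : adj G u v ≡ true
            auv = trans (SimpleGraph.sym G u v) avu

    odd-nonNeighbour : ∀ u → degree G u ≢ 0 → (nu : v ≢ u) → adj G v u ≡ false → OddAt u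
    odd-nonNeighbour u dnz nu avu with proj₂ niceH (punchOut nu) (λ z → dnz (trans (degree-lower u nu uv) z))
      where uv = trans (SimpleGraph.sym G u v) avu
    ... | j , oj = j , trans (cong (_% 2) classes) oj
      where
      classes : count (λ w → adj G u w ∧ (c w == j)) ≡ count (λ x → adj H (punchOut nu) x ∧ (cH x == j))
      classes = trans (class-extend col u j)
        (trans (cong (λ z → ind (z ∧ (col == j)) + classH u j) (trans (SimpleGraph.sym G u v) avu))
               (count-cong _ _ (λ x → cong (_∧ (cH x == j)) (adj-lower u nu x))))

    oddCondition : OddCondition G c
    oddCondition u dnz with isOdd (degree G u) in odd
    ... | true = oddColourClass (adj G u) c odd
    ... | false with v ≟F u
    ...   | yes refl = ⊥-elim (true≢false (trans (sym vOdd) odd))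
    ...   | no nu with adj G v u in avu
    ...     | true = odd-evenNeighbour u (cong not odd) avu
    ...     | false = odd-nonNeighbour u dnz nu avu

  extends : isOdd (degree G v) ≡ true → degree G v + count (λ u → adj G v u ∧ even u) < 9 →
    HasNiceColouring G
  extends vOdd few with count<n⇒∃ forbidden (≤-<-trans count-forbidden few)
  ... | col , allowed = c , proper , oddCondition
    where open Allowed vOdd col allowed

few-forbidden : ∀ {n} (G : SimpleGraph n) v → degree G v ≡ 5 →
  2 ≤ count (λ u → adj G v u ∧ isOdd (degree G u)) →
  degree G v + count (λ u → adj G v u ∧ not (isOdd (degree G u))) < 9
few-forbidden G v deg5 twoOdd rewrite deg5 = s≤s (+-monoʳ-≤ 5 evens≤3)
  where
  evens : ℕ
  evens = count (λ u → adj G v u ∧ not (isOdd (degree G u)))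
  evens≤3 : evens ≤ 3
  evens≤3 = +-cancelˡ-≤ 2 evens 3 (≤-trans (+-monoˡ-≤ evens twoOdd)
              (≤-reflexive (sym (trans (sym deg5) (count-split (adj G v) (λ u → isOdd (degree G u)))))))

two-odd-neighbours⇒nice : ∀ {m} (G : SimpleGraph (suc m)) (v : Fin (suc m)) →
  ((k : ℕ) → k < suc m → (H : SimpleGraph k) → EmbeddableInTorus H → HasNiceColouring H) →
  degree G v ≡ 5 → 2 ≤ count (λ u → adj G v u ∧ isOdd (degree G u)) →
  (Σ (SimpleGraph (suc m)) λ G₀ → EmbeddableInTorus G₀ × Isolated G₀ v × AgreeOff v G₀ G) →
  HasNiceColouring G
two-odd-neighbours⇒nice {m} G v minimal deg5 twoOdd (G₀ , emb₀ , iso₀ , agree₀) =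
  extend (minimal m (n<1+n m) H (embeddable-H emb₀))
  where
  open RemoveIsolated G₀ v iso₀ using (H; embeddable-H)
  extend : HasNiceColouring H → HasNiceColouring G
  extend (cH , niceH) = ColourExtension.extends G v G₀ iso₀ agree₀ cH niceH
                          (cong isOdd deg5) (few-forbidden G v deg5 twoOdd)

claim3p1 : (n : ℕ) (G : SimpleGraph n) → EmbeddableInTorus G → ¬ HasNiceColouring G →
    ((m : ℕ) → m < n → (H : SimpleGraph m) → EmbeddableInTorus H → HasNiceColouring H) →
    (v : Fin n) → degree G v ≡ 5 →
    count (λ u → adj G v u ∧ isOdd (degree G u)) ≤ 1
claim3p1 zero G emb noNice minimal () deg5
claim3p1 (suc m) G emb noNice minimal v deg5 with count (λ u → adj G v u ∧ isOdd (degree G u)) ≤? 1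
... | yes atMostOne = atMostOne
... | no moreThanOne = ⊥-elim (noNice (two-odd-neighbours⇒nice G v minimal deg5 (≰⇒> moreThanOne)
                                         (isolateVertex 5 G v deg5 emb)))
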